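{- Let $n\ge0$, $\sigma\in\mathfrak S_n$ and $\rho:=\mathrm F_2^{\rm loc}(\sigma)$. Then $(\mathrm{PIX},\mathrm{mag})\,\sigma=(\mathrm{PIX},\mathrm{inv})\,\rho$.
   Context: Permutations are words $\sigma(1)\cdots\sigma(n)$. For a word $x_1\cdots x_n$, $\mathrm{DES}=\{i\le n-1:x_i>x_{i+1}\}$, $\mathrm{maj}=\sum_{i\in\mathrm{DES}}i$. $\mathrm{IDES}\,\sigma=\mathrm{DES}\,\sigma^{ -1}$, $\mathrm{imaj}\,\sigma=\sum_{i\in\mathrm{IDES}\,\sigma}i$, $\mathrm{inv}\,\sigma=\#\{(i,j):i<j,\ \sigma(i)>\sigma(j)\}$. A word $y_1\cdots y_m$ with distinct letters is a desarrangement if $y_1>\dots>y_{2k}<y_{2k+1}$ for some $k\ge1$ (convention $y_{m+1}=\infty$). Each $\sigma$ factors uniquely as $\sigma^p\sigma^d$ with $\sigma^p$ increasing and $\sigma^d$ the longest right factor that is a desarrangement. $\mathrm{PIX}\,\sigma$ = set of letters of $\sigma^p$, $\mathrm{pix}=\#\mathrm{PIX}$; $\mathrm{Desar}\,\sigma\in\mathfrak S_m$ is $\sigma^d$ reduced order-preservingly to $\{1,\dots,m\}$. $\mathrm{mag}\,\sigma=\sum_{i\in\mathrm{PIX}\,\sigma}i-\sum_{i=1}^{\mathrm{pix}\,\sigma}i+\mathrm{imaj}(\mathrm{Desar}\,\sigma)$. For every $A\subseteq[n]$ and desarrangement $\delta\in\mathfrak S_{n-|A|}$ there is a unique $\sigma$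 with $(\mathrm{PIX}\,\sigma,\mathrm{Desar}\,\sigma)=(A,\delta)$. $\mathrm F_2$ denotes Foata's second fundamental transformation, a bijection of each $\mathfrak S_m$ onto itself with $\mathrm{inv}\,\mathrm F_2(\pi)=\mathrm{maj}\,\pi$ and $\mathrm{IDES}\,\mathrm F_2(\pi)=\mathrm{IDES}\,\pi$. Let $\mathrm F_2'(\pi):=(\mathrm F_2(\pi^{ -1}))^{ -1}$; then $\mathrm{inv}\,\mathrm F_2'(\pi)=\mathrm{imaj}\,\pi$ and $\mathrm{DES}\,\mathrm F_2'(\pi)=\mathrm{DES}\,\pi$, so $\mathrm F_2'$ maps desarrangements to desarrangements. $\mathrm F_2^{\rm loc}(\sigma)$ is the permutation $\rho$ with $(\mathrm{PIX}\,\rho,\mathrm{Desar}\,\rho)=(\mathrm{PIX}\,\sigma,\mathrm F_2'(\mathrm{Desar}\,\sigma))$. -}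

module Defs where

open import Data.Bool using (Bool; true; false; if_then_else_; not; _∨_)
open import Data.Nat using (ℕ; zero; suc; _+_; _∸_; _≤ᵇ_; _<ᵇ_; _≡ᵇ_)
open import Data.List using (List; []; _∷_; _++_; map; length; take; drop; upTo; reverse; foldl)
open import Data.Nat.ListAction using (sum)
open import Data.Maybe using (Maybe; just; nothing)

-- Words are lists of natural numbers; permutations of [n] are words that
-- are a rearrangement of 1 ⋯ n.

oneTo : ℕ → List ℕ
oneTo n = map suc (upTo n)

countB : (ℕ → Bool) → List ℕ → ℕ
countB p [] = 0
countB p (x ∷ xs) = if p x then suc (countB p xs) else countB p xs

majFrom : ℕ → List ℕ → ℕ
majFrom i [] = 0
majFrom i (x ∷ []) = 0
majFrom i (x ∷ y ∷ ys) = (if y <ᵇ x then i else 0) + majFrom (suc i) (y ∷ ys)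

maj : List ℕ → ℕ
maj w = majFrom 1 w

inv : List ℕ → ℕ
inv [] = 0
inv (x ∷ xs) = countB (λ y → y <ᵇ x) xs + inv xs

-- 1-based position of letter a in a word (0 if absent)
posOf : ℕ → List ℕ → ℕ
posOf a [] = 0
posOf a (x ∷ xs) = if x ≡ᵇ a then 1 else suc (posOf a xs)

inverse : List ℕ → List ℕ
inverse π = map (λ i → posOf i π) (oneTo (length π))

-- imaj π = maj π⁻¹  (= sum of IDES π, IDES π = DES π⁻¹)
imaj : List ℕ → ℕ
imaj π = maj (inverse π)

-- length of the initial strictly decreasing run (with y_{m+1} = ∞)
decRun : List ℕ → ℕ
decRun [] = 0
decRun (x ∷ []) = 1
decRun (x ∷ y ∷ ys) = if y <ᵇ x then suc (decRun (y ∷ ys)) else 1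

even : ℕ → Bool
even zero = true
even (suc zero) = false
even (suc (suc n)) = even n

-- desarrangement: y1 > ⋯ > y_{2k} < y_{2k+1} for some k ≥ 1 (y_{m+1}=∞),
-- i.e. the first ascent is at an even position; the empty word is a
-- desarrangement by convention (needed for the unique factorisation).
isDesarr : List ℕ → Bool
isDesarr [] = true
isDesarr (x ∷ xs) = even (decRun (x ∷ xs))

-- length of σ^p: the smallest k such that drop k σ is a desarrangement,
-- i.e. σ^d is the longest right factor which is a desarrangement
pixLen : List ℕ → ℕ
pixLen [] = 0
pixLen (x ∷ xs) = if isDesarr (x ∷ xs) then 0 else suc (pixLen xs)

pixPart : List ℕ → List ℕ
pixPart σ = take (pixLen σ) σ

desPart : List ℕ → List ℕ
desPart σ = drop (pixLen σ) σ

-- PIX σ : letters of σ^p (σ^p is increasing, so this is the set listed increasingly)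
PIX : List ℕ → List ℕ
PIX σ = pixPart σ

pix : List ℕ → ℕ
pix σ = length (PIX σ)

standardize : List ℕ → List ℕ
standardize w = map (λ y → suc (countB (λ z → z <ᵇ y) w)) w

Desar : List ℕ → List ℕ
Desar σ = standardize (desPart σ)

-- mag σ = Σ_{i∈PIX σ} i − Σ_{i=1}^{pix σ} i + imaj (Desar σ)
-- (the truncated subtraction is exact: PIX σ is a set of pix σ positive integers)
mag : List ℕ → ℕ
mag σ = (sum (PIX σ) ∸ sum (oneTo (pix σ))) + imaj (Desar σ)

-- Foata's second fundamental transformation F2 (Foata's bijection Φ).
-- γ_1 = x_1; given γ_{i-1} and x_i: if the last letter of γ_{i-1} is ≤ x_i,
-- cut γ_{i-1} after every letter ≤ x_i, otherwise after every letter > x_i;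
-- in each compartment move the last letter to the front; then append x_i.

-- cut after each letter satisfying p and cyclically shift each compartment
shiftBy : (ℕ → Bool) → List ℕ → List ℕ → List ℕ
shiftBy p acc [] = reverse acc
shiftBy p acc (a ∷ as) =
  if p a then (a ∷ reverse acc) ++ shiftBy p [] as else shiftBy p (a ∷ acc) as

lastL : List ℕ → Maybe ℕ
lastL [] = nothing
lastL (x ∷ []) = just x
lastL (x ∷ y ∷ ys) = lastL (y ∷ ys)

foataStep : List ℕ → ℕ → List ℕ
foataStep γ x with lastL γ
... | nothing = x ∷ []
... | just l  = (if l ≤ᵇ x then shiftBy (λ a → a ≤ᵇ x) [] γ
                           else shiftBy (λ a → not (a ≤ᵇ x)) [] γ) ++ (x ∷ [])

F2 : List ℕ → List ℕ
F2 w = foldl foataStep [] w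

F2' : List ℕ → List ℕ
F2' π = inverse (F2 (inverse π))

-- F2loc σ: the permutation ρ with PIX ρ = PIX σ and Desar ρ = F2'(Desar σ),
-- built explicitly: the letters of PIX σ in increasing order, followed by
-- F2'(Desar σ) relabelled order-preservingly onto [n] ∖ PIX σ.

elemB : ℕ → List ℕ → Bool
elemB a [] = false
elemB a (x ∷ xs) = (x ≡ᵇ a) ∨ elemB a xs

filterB : (ℕ → Bool) → List ℕ → List ℕ
filterB p [] = []
filterB p (x ∷ xs) = if p x then x ∷ filterB p xs else filterB p xs

-- j-th letter (1-based) of a word, 0 if out of range
at : List ℕ → ℕ → ℕ
at [] j = 0
at (x ∷ xs) zero = 0
at (x ∷ xs) (suc zero) = x
at (x ∷ xs) (suc (suc j)) = at xs (suc j)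

F2loc : List ℕ → List ℕ
F2loc σ =
  PIX σ ++ map (at (filterB (λ i → not (elemB i (PIX σ))) (oneTo (length σ))))
                   (F2' (Desar σ))

-- Write σ = σᵖ σᵈ with σᵖ increasing; then F2loc σ = σᵖ E, where E is F2'(Desar σ) relabelled
-- order-preservingly onto [n] ∖ PIX σ. Such relabellings keep descents and inversions, and F2'
-- keeps descents: the descents of π⁻¹ record whether i + 1 comes before i in π, and no cut of
-- Foata's algorithm separates the values i and i + 1. So E is again a desarrangement and
-- PIX (F2loc σ) = PIX σ. Since σᵖ is increasing, inv (σᵖ E) = inv E + #{(p, e) : p ∈ σᵖ, e ∈ E, e < p}.
-- The first term is inv F2(δ⁻¹)⁻¹ = inv F2(δ⁻¹) = maj δ⁻¹ = imaj δ, by inv π⁻¹ = inv π and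
-- Foata's inv ∘ F2 = maj. In the second, the i-th smallest letter p of PIX σ has p − 1 smaller
-- letters in [n], of which i − 1 lie in PIX σ, so the count is Σ PIX σ − (1 + ⋯ + pix σ).

module Submission where

open import Defs
open import Data.Bool using (Bool; true; false; if_then_else_; not; _∧_)
open import Data.Bool.Properties using (T-≡; ∧-comm; ∧-zeroʳ; ∧-identityʳ)
open import Data.Empty using (⊥-elim)
open import Data.List using (List; []; _∷_; _++_; map; length; take; reverse; applyUpTo)
import Data.List.Properties as List
open import Data.List.Membership.Propositional using (_∈_; _∉_)
open import Data.List.Membership.Propositional.Properties using (∈-map⁻; ∈-++⁺ˡ; ∈-++⁺ʳ)
open import Data.List.Relation.Binary.Permutation.Propositional
  using (_↭_; ↭-refl; ↭-sym; ↭-trans; ↭-prep; ↭-swap; ↭-reflexive)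
import Data.List.Relation.Binary.Permutation.Propositional as ↭
import Data.List.Relation.Binary.Permutation.Propositional.Properties as Perm
open import Data.List.Relation.Unary.All as All using (All; []; _∷_)
open import Data.List.Relation.Unary.AllPairs as AllPairs using (AllPairs; []; _∷_)
open import Data.List.Relation.Unary.Any using (here; there)
open import Data.List.Relation.Unary.Linked as Linked using (Linked; []; [-]; _∷_)
open import Data.List.Relation.Unary.Linked.Properties using (Linked⇒AllPairs)
open import Data.List.Relation.Unary.Unique.Propositional using (Unique)
open import Data.Maybe using (just)
open import Data.Nat using (ℕ; zero; suc; _+_; _*_; _∸_; _≤_; _<_; _≮_; _≰_; z≤n; s≤s; _≤ᵇ_; _<ᵇ_; _≡ᵇ_)
open import Data.Nat.ListAction using (sum)
open import Data.Nat.ListAction.Properties using (sum-++; sum-↭)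
open import Data.Nat.Properties
open import Data.List.Membership.DecPropositional _≟_ using (_∈?_)
open import Data.Nat.Tactic.RingSolver using (solve-∀)
open import Data.Product using (_×_; _,_; proj₁; proj₂; Σ)
open import Data.Sum using (_⊎_; inj₁; inj₂)
open import Function using (_∘_; Equivalence)
open import Relation.Binary.Definitions using (tri<; tri≈; tri>)
open import Relation.Binary.PropositionalEquality
open import Relation.Nullary using (¬_; Dec; yes; no; contradiction)

<⇒<ᵇ≡true : ∀ {m n} → m < n → (m <ᵇ n) ≡ true
<⇒<ᵇ≡true m<n = Equivalence.to T-≡ (<⇒<ᵇ m<n)

<ᵇ≡true⇒< : ∀ {m n} → (m <ᵇ n) ≡ true → m < n
<ᵇ≡true⇒< {m} {n} e = <ᵇ⇒< m n (Equivalence.from T-≡ e)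

≮⇒<ᵇ≡false : ∀ {m n} → m ≮ n → (m <ᵇ n) ≡ false
≮⇒<ᵇ≡false {m} {n} m≮n with m <ᵇ n in e
... | false = refl
... | true  = ⊥-elim (m≮n (<ᵇ≡true⇒< e))

<ᵇ≡false⇒≮ : ∀ {m n} → (m <ᵇ n) ≡ false → m ≮ n
<ᵇ≡false⇒≮ e m<n = contradiction (trans (sym (<⇒<ᵇ≡true m<n)) e) λ ()

≤⇒≤ᵇ≡true : ∀ {m n} → m ≤ n → (m ≤ᵇ n) ≡ true
≤⇒≤ᵇ≡true m≤n = Equivalence.to T-≡ (≤⇒≤ᵇ m≤n)

≤ᵇ≡true⇒≤ : ∀ {m n} → (m ≤ᵇ n) ≡ true → m ≤ n
≤ᵇ≡true⇒≤ {m} {n} e = ≤ᵇ⇒≤ m n (Equivalence.from T-≡ e)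

≰⇒≤ᵇ≡false : ∀ {m n} → m ≰ n → (m ≤ᵇ n) ≡ false
≰⇒≤ᵇ≡false {m} {n} m≰n with m ≤ᵇ n in e
... | false = refl
... | true  = ⊥-elim (m≰n (≤ᵇ≡true⇒≤ e))

≤ᵇ≡false⇒> : ∀ {m n} → (m ≤ᵇ n) ≡ false → n < m
≤ᵇ≡false⇒> e = ≰⇒> λ m≤n → contradiction (trans (sym (≤⇒≤ᵇ≡true m≤n)) e) λ ()

≡⇒≡ᵇ≡true : ∀ {m n} → m ≡ n → (m ≡ᵇ n) ≡ true
≡⇒≡ᵇ≡true {m} {n} m≡n = Equivalence.to T-≡ (≡⇒≡ᵇ m n m≡n)

≡ᵇ≡true⇒≡ : ∀ {m n} → (m ≡ᵇ n) ≡ true → m ≡ n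
≡ᵇ≡true⇒≡ {m} {n} e = ≡ᵇ⇒≡ m n (Equivalence.from T-≡ e)

≢⇒≡ᵇ≡false : ∀ {m n} → m ≢ n → (m ≡ᵇ n) ≡ false
≢⇒≡ᵇ≡false {m} {n} m≢n with m ≡ᵇ n in e
... | false = refl
... | true  = ⊥-elim (m≢n (≡ᵇ≡true⇒≡ e))

<ᵇ-cong-⇔ : ∀ {a b c d} → (a < b → c < d) → (c < d → a < b) → (a <ᵇ b) ≡ (c <ᵇ d)
<ᵇ-cong-⇔ {a} {b} f g with a <? b
... | yes a<b = trans (<⇒<ᵇ≡true a<b) (sym (<⇒<ᵇ≡true (f a<b)))
... | no  a≮b = trans (≮⇒<ᵇ≡false a≮b) (sym (≮⇒<ᵇ≡false (a≮b ∘ g)))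

not-≤ᵇ : ∀ a x → not (a ≤ᵇ x) ≡ (x <ᵇ a)
not-≤ᵇ a x with a ≤? x
... | yes a≤x = trans (cong not (≤⇒≤ᵇ≡true a≤x)) (sym (≮⇒<ᵇ≡false (≤⇒≯ a≤x)))
... | no  a≰x = trans (cong not (≰⇒≤ᵇ≡false a≰x)) (sym (<⇒<ᵇ≡true (≰⇒> a≰x)))

even-suc : ∀ k → even (suc k) ≡ not (even k)
even-suc zero          = refl
even-suc (suc zero)    = refl
even-suc (suc (suc k)) = even-suc k

indicator : Bool → ℕ
indicator b = if b then 1 else 0

countB-++ : ∀ p xs ys → countB p (xs ++ ys) ≡ countB p xs + countB p ys
countB-++ p []       ys = refl
countB-++ p (x ∷ xs) ys with p x
... | true  = cong suc (countB-++ p xs ys)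
... | false = countB-++ p xs ys

countB-∷ : ∀ p y ys → countB p (y ∷ ys) ≡ indicator (p y) + countB p ys
countB-∷ p y ys with p y
... | true  = refl
... | false = refl

countB-↭ : ∀ p {xs ys} → xs ↭ ys → countB p xs ≡ countB p ys
countB-↭ p ↭.refl = refl
countB-↭ p (↭.prep x q) with p x
... | true  = cong suc (countB-↭ p q)
... | false = countB-↭ p q
countB-↭ p (↭.swap x y q) with p x | p y
... | true  | true  = cong (2 +_) (countB-↭ p q)
... | true  | false = cong suc (countB-↭ p q)
... | false | true  = cong suc (countB-↭ p q)
... | false | false = countB-↭ p q
countB-↭ p (↭.trans q r) = trans (countB-↭ p q) (countB-↭ p r)

countB-cong : ∀ p q xs → (∀ {x} → x ∈ xs → p x ≡ q x) → countB p xs ≡ countB q xs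
countB-cong p q []       h = refl
countB-cong p q (x ∷ xs) h rewrite h (here refl) with q x
... | true  = cong suc (countB-cong p q xs (h ∘ there))
... | false = countB-cong p q xs (h ∘ there)

countB-none : ∀ p {xs} → All (λ x → p x ≡ false) xs → countB p xs ≡ 0
countB-none p []         = refl
countB-none p (px ∷ pxs) rewrite px = countB-none p pxs

countB-all : ∀ p {xs} → All (λ x → p x ≡ true) xs → countB p xs ≡ length xs
countB-all p []         = refl
countB-all p (px ∷ pxs) rewrite px = cong suc (countB-all p pxs)

countB-+-countB-not : ∀ p xs → countB p xs + countB (not ∘ p) xs ≡ length xs
countB-+-countB-not p []       = refl
countB-+-countB-not p (x ∷ xs) with p x
... | true  = cong suc (countB-+-countB-not p xs)
... | false = trans (+-suc _ _) (cong suc (countB-+-countB-not p xs))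

countB-map : ∀ p (f : ℕ → ℕ) xs → countB p (map f xs) ≡ countB (p ∘ f) xs
countB-map p f []       = refl
countB-map p f (x ∷ xs) with p (f x)
... | true  = cong suc (countB-map p f xs)
... | false = countB-map p f xs

countB≤length : ∀ p xs → countB p xs ≤ length xs
countB≤length p []       = z≤n
countB≤length p (x ∷ xs) with p x
... | true  = s≤s (countB≤length p xs)
... | false = m≤n⇒m≤1+n (countB≤length p xs)

countB<length : ∀ p {xs y} → y ∈ xs → p y ≡ false → countB p xs < length xs
countB<length p {x ∷ xs} (here refl) e rewrite e = s≤s (countB≤length p xs)
countB<length p {x ∷ xs} (there m)   e with p x
... | true  = s≤s (countB<length p m e)
... | false = m≤n⇒m≤1+n (countB<length p m e)

countB≡sum-indicator : ∀ p xs → countB p xs ≡ sum (map (indicator ∘ p) xs)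
countB≡sum-indicator p []       = refl
countB≡sum-indicator p (x ∷ xs) with p x
... | true  = cong suc (countB≡sum-indicator p xs)
... | false = countB≡sum-indicator p xs

sum-map-cong : ∀ (f g : ℕ → ℕ) xs → (∀ {x} → x ∈ xs → f x ≡ g x) → sum (map f xs) ≡ sum (map g xs)
sum-map-cong f g xs h = cong sum (List.map-cong-local (All.tabulate h))

sum-map-↭ : ∀ (f : ℕ → ℕ) {xs ys} → xs ↭ ys → sum (map f xs) ≡ sum (map f ys)
sum-map-↭ f = sum-↭ ∘ Perm.map⁺ f

sum-map-+ : ∀ (f g : ℕ → ℕ) xs → sum (map (λ x → f x + g x) xs) ≡ sum (map f xs) + sum (map g xs)
sum-map-+ f g []       = refl
sum-map-+ f g (x ∷ xs) rewrite sum-map-+ f g xs = lemma (f x) (g x) (sum (map f xs)) (sum (map g xs))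
  where
  lemma : ∀ a b c d → a + b + (c + d) ≡ a + c + (b + d)
  lemma = solve-∀

sum-map-const : ∀ {A : Set} c (xs : List A) → sum (map (λ _ → c) xs) ≡ length xs * c
sum-map-const c []       = refl
sum-map-const c (x ∷ xs) = cong (c +_) (sum-map-const c xs)

sum-map-comm : ∀ (f : ℕ → ℕ → ℕ) xs ys →
  sum (map (λ x → sum (map (f x) ys)) xs) ≡ sum (map (λ y → sum (map (λ x → f x y) xs)) ys)
sum-map-comm f []       ys = sym (trans (sum-map-const 0 ys) (*-zeroʳ (length ys)))
sum-map-comm f (x ∷ xs) ys = begin
  sum (map (f x) ys) + sum (map (λ x → sum (map (f x) ys)) xs)
    ≡⟨ cong (sum (map (f x) ys) +_) (sum-map-comm f xs ys) ⟩
  sum (map (f x) ys) + sum (map (λ y → sum (map (λ x → f x y) xs)) ys)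
    ≡⟨ sum-map-+ (f x) (λ y → sum (map (λ x → f x y) xs)) ys ⟨
  sum (map (λ y → f x y + sum (map (λ x → f x y) xs)) ys) ∎
  where open ≡-Reasoning

Unique-resp-↭ : ∀ {xs ys : List ℕ} → xs ↭ ys → Unique xs → Unique ys
Unique-resp-↭ ↭.refl           u = u
Unique-resp-↭ (↭.prep x q)     (x∉ ∷ u) = Perm.All-resp-↭ q x∉ ∷ Unique-resp-↭ q u
Unique-resp-↭ (↭.swap x y q)   ((x≢y ∷ x∉) ∷ y∉ ∷ u) =
  ((x≢y ∘ sym) ∷ Perm.All-resp-↭ q y∉) ∷ Perm.All-resp-↭ q x∉ ∷ Unique-resp-↭ q u
Unique-resp-↭ (↭.trans q r)    u = Unique-resp-↭ r (Unique-resp-↭ q u)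

Unique-++⁻ˡ : ∀ xs {ys : List ℕ} → Unique (xs ++ ys) → Unique xs
Unique-++⁻ˡ []       u        = []
Unique-++⁻ˡ (x ∷ xs) (x∉ ∷ u) = All.tabulate (All.lookup x∉ ∘ ∈-++⁺ˡ) ∷ Unique-++⁻ˡ xs u

Unique-++⁻ʳ : ∀ xs {ys : List ℕ} → Unique (xs ++ ys) → Unique ys
Unique-++⁻ʳ []       u       = u
Unique-++⁻ʳ (x ∷ xs) (_ ∷ u) = Unique-++⁻ʳ xs u

Unique-++⇒∉ : ∀ xs {ys : List ℕ} {x} → Unique (xs ++ ys) → x ∈ xs → x ∉ ys
Unique-++⇒∉ (x ∷ xs) (x∉ ∷ u) (here refl) x∈ys = All.lookup x∉ (∈-++⁺ʳ xs x∈ys) refl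
Unique-++⇒∉ (x ∷ xs) (_ ∷ u)  (there m)   x∈ys = Unique-++⇒∉ xs u m x∈ys

Unique-map⁺ : ∀ (f : ℕ → ℕ) {xs} → (∀ {x y} → x ∈ xs → y ∈ xs → f x ≡ f y → x ≡ y) →
              Unique xs → Unique (map f xs)
Unique-map⁺ f {[]}     inj []       = []
Unique-map⁺ f {x ∷ xs} inj (x∉ ∷ u) =
  All.tabulate fx∉ ∷ Unique-map⁺ f (λ mx my → inj (there mx) (there my)) u
  where
  fx∉ : ∀ {z} → z ∈ map f xs → f x ≢ z
  fx∉ m e with y , my , refl ← ∈-map⁻ f m = All.lookup x∉ my (inj (here refl) (there my) e)

removeMember : ∀ {x} v → x ∈ v → Σ (List ℕ) λ v′ →
  (v ↭ x ∷ v′) × (∀ {y} → y ∈ v → y ≢ x → y ∈ v′) × (length v ≡ suc (length v′))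
removeMember (x ∷ v) (here refl) =
  v , ↭-refl , (λ { (here refl) y≢x → ⊥-elim (y≢x refl) ; (there m) _ → m }) , refl
removeMember {x} (z ∷ v) (there m) with v′ , q , keep , len ← removeMember v m =
  z ∷ v′ , ↭-trans (↭-prep z q) (↭-swap z x ↭-refl) ,
  (λ { (here refl) _ → here refl ; (there m′) y≢x → there (keep m′ y≢x) }) , cong suc len

Unique-⊆-length⇒↭ : ∀ u v → Unique u → (∀ {x} → x ∈ u → x ∈ v) → length v ≤ length u → u ↭ v
Unique-⊆-length⇒↭ []      []      _          _   _  = ↭-refl
Unique-⊆-length⇒↭ (x ∷ u) v       (x∉ ∷ uu) u⊆v len
  with v′ , q , keep , len′ ← removeMember v (u⊆v (here refl)) =
  ↭-trans (↭-prep x (Unique-⊆-length⇒↭ u v′ uu (λ m → keep (u⊆v (there m)) (All.lookup x∉ m ∘ sym))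
                       (≤-pred (subst (_≤ suc (length u)) len′ len))))
          (↭-sym q)

range : ℕ → ℕ → List ℕ
range a zero    = []
range a (suc k) = a ∷ range (suc a) k

applyUpTo≡range : ∀ (f : ℕ → ℕ) a k → (∀ i → f i ≡ a + i) → applyUpTo f k ≡ range a k
applyUpTo≡range f a zero    h = refl
applyUpTo≡range f a (suc k) h =
  cong₂ _∷_ (trans (h 0) (+-identityʳ a))
            (applyUpTo≡range (f ∘ suc) (suc a) k (λ i → trans (h (suc i)) (+-suc a i)))

oneTo≡range : ∀ n → oneTo n ≡ range 1 n
oneTo≡range n = trans (List.map-upTo suc n) (applyUpTo≡range suc 1 n (λ _ → refl))

range-suc : ∀ a k → range (suc a) k ≡ map suc (range a k)
range-suc a zero    = refl
range-suc a (suc k) = cong (suc a ∷_) (range-suc (suc a) k)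

length-range : ∀ a k → length (range a k) ≡ k
length-range a zero    = refl
length-range a (suc k) = cong suc (length-range (suc a) k)

∈-range⁻ : ∀ {a k i} → i ∈ range a k → a ≤ i × i < a + k
∈-range⁻ {a} {suc k} (here refl) = ≤-refl , subst (a <_) (sym (+-suc a k)) (s≤s (m≤m+n a k))
∈-range⁻ {a} {suc k} {i} (there m) with a<i , i<a+k ← ∈-range⁻ {suc a} {k} m =
  <⇒≤ a<i , subst (i <_) (sym (+-suc a k)) i<a+k

∈-range⁺ : ∀ {a k i} → a ≤ i → i < a + k → i ∈ range a k
∈-range⁺ {a} {zero}  a≤i i<a = ⊥-elim (<⇒≱ i<a (subst (_≤ _) (sym (+-identityʳ a)) a≤i))
∈-range⁺ {a} {suc k} {i} a≤i i<a+k with a ≟ i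
... | yes refl = here refl
... | no  a≢i  = there (∈-range⁺ (≤∧≢⇒< a≤i a≢i) (subst (i <_) (+-suc a k) i<a+k))

∈-oneTo⁻ : ∀ {m i} → i ∈ range 1 m → Σ ℕ λ j → (i ≡ suc j) × (j < m)
∈-oneTo⁻ {m} m∈ with ∈-range⁻ {1} {m} m∈
... | s≤s z≤n , s≤s j<m = _ , refl , j<m

∈-oneTo⁺ : ∀ {m j} → j < m → suc j ∈ range 1 m
∈-oneTo⁺ j<m = ∈-range⁺ (s≤s z≤n) (s≤s j<m)

range-ascending : ∀ a k → AllPairs _<_ (range a k)
range-ascending a zero    = []
range-ascending a (suc k) = All.tabulate (proj₁ ∘ ∈-range⁻ {suc a} {k}) ∷ range-ascending (suc a) k

ascending⇒Unique : ∀ {xs} → AllPairs _<_ xs → Unique xs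
ascending⇒Unique = AllPairs.map <⇒≢

at-range : ∀ a k j → j < k → at (range a k) (suc j) ≡ a + j
at-range a (suc k) zero    _         = sym (+-identityʳ a)
at-range a (suc k) (suc j) (s≤s j<k) = trans (at-range (suc a) k j j<k) (sym (+-suc a j))

at-map : ∀ (f : ℕ → ℕ) xs j → j < length xs → at (map f xs) (suc j) ≡ f (at xs (suc j))
at-map f (x ∷ xs) zero    _         = refl
at-map f (x ∷ xs) (suc j) (s≤s j<n) = at-map f xs j j<n

at-∈ : ∀ xs j → j < length xs → at xs (suc j) ∈ xs
at-∈ (x ∷ xs) zero    _         = here refl
at-∈ (x ∷ xs) (suc j) (s≤s j<n) = there (at-∈ xs j j<n)

at-ascending : ∀ xs {i j} → AllPairs _<_ xs → i < j → j < length xs → at xs (suc i) < at xs (suc j)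
at-ascending (x ∷ xs) {zero}  {suc j} (x< ∷ _)  _         (s≤s j<n) = All.lookup x< (at-∈ xs j j<n)
at-ascending (x ∷ xs) {suc i} {suc j} (_ ∷ asc) (s≤s i<j) (s≤s j<n) = at-ascending xs asc i<j j<n

posOf-here : ∀ x xs → posOf x (x ∷ xs) ≡ 1
posOf-here x xs rewrite ≡⇒≡ᵇ≡true {x} refl = refl

posOf-there : ∀ {x b} xs → x ≢ b → posOf b (x ∷ xs) ≡ suc (posOf b xs)
posOf-there xs x≢b rewrite ≢⇒≡ᵇ≡false x≢b = refl

posOf-∈ : ∀ a w → a ∈ w → Σ ℕ λ j → (posOf a w ≡ suc j) × (j < length w) × (at w (suc j) ≡ a)
posOf-∈ a (x ∷ xs) m with x ≡ᵇ a in e | m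
... | true  | _          = 0 , refl , s≤s z≤n , ≡ᵇ≡true⇒≡ e
... | false | here refl  = contradiction (trans (sym (≡⇒≡ᵇ≡true {a} refl)) e) λ ()
... | false | there m′ with j , p , j<n , atj ← posOf-∈ a xs m′ = suc j , cong suc p , s≤s j<n , atj

posOf-at : ∀ w j → Unique w → j < length w → posOf (at w (suc j)) w ≡ suc j
posOf-at (x ∷ xs) zero    _        _         = posOf-here x xs
posOf-at (x ∷ xs) (suc j) (x∉ ∷ u) (s≤s j<n) =
  trans (posOf-there xs (All.lookup x∉ (at-∈ xs j j<n))) (cong suc (posOf-at xs j u j<n))

at-ext : ∀ u v → length u ≡ length v → (∀ j → j < length u → at u (suc j) ≡ at v (suc j)) → u ≡ v
at-ext []      []      _   _ = refl
at-ext (x ∷ u) (y ∷ v) len h =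
  cong₂ _∷_ (h 0 (s≤s z≤n)) (at-ext u v (suc-injective len) (λ j j<n → h (suc j) (s≤s j<n)))

≡map-at : ∀ xs → xs ≡ map (at xs) (range 1 (length xs))
≡map-at xs = at-ext xs (map (at xs) (range 1 n)) (sym (trans (List.length-map _ (range 1 n)) (length-range 1 n)))
  λ j j<n → sym (trans (at-map (at xs) (range 1 n) j (subst (j <_) (sym (length-range 1 n)) j<n))
                       (cong (at xs) (at-range 1 n j j<n)))
  where n = length xs

IsPermutation : ℕ → List ℕ → Set
IsPermutation m π = π ↭ range 1 m

module _ {m π} (π↭ : IsPermutation m π) where

  IsPermutation⇒Unique : Unique π
  IsPermutation⇒Unique = Unique-resp-↭ (↭-sym π↭) (ascending⇒Unique (range-ascending 1 m))

  IsPermutation⇒length : length π ≡ m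
  IsPermutation⇒length = trans (Perm.↭-length π↭) (length-range 1 m)

  IsPermutation-∈ : ∀ {x} → x ∈ π → Σ ℕ λ j → (x ≡ suc j) × (j < m)
  IsPermutation-∈ = ∈-oneTo⁻ ∘ Perm.∈-resp-↭ π↭

  IsPermutation-∋ : ∀ {j} → j < m → suc j ∈ π
  IsPermutation-∋ = Perm.∈-resp-↭ (↭-sym π↭) ∘ ∈-oneTo⁺

  IsPermutation-<length : ∀ {j} → j < m → j < length π
  IsPermutation-<length = subst (_ <_) (sym IsPermutation⇒length)

module _ {m π} (π↭ : IsPermutation m π) where

  inverse≡ : inverse π ≡ map (λ i → posOf i π) (range 1 m)
  inverse≡ = trans (cong (λ k → map (λ i → posOf i π) (oneTo k)) (IsPermutation⇒length π↭))
                   (cong (map (λ i → posOf i π)) (oneTo≡range m))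

  at-inverse : ∀ j → j < m → at (inverse π) (suc j) ≡ posOf (suc j) π
  at-inverse j j<m rewrite inverse≡ =
    trans (at-map _ (range 1 m) j (subst (j <_) (sym (length-range 1 m)) j<m))
          (cong (λ z → posOf z π) (at-range 1 m j j<m))

  inverse-IsPermutation : IsPermutation m (inverse π)
  inverse-IsPermutation rewrite inverse≡ =
    Unique-⊆-length⇒↭ (map (λ i → posOf i π) (range 1 m)) (range 1 m)
      (Unique-map⁺ _ injective (ascending⇒Unique (range-ascending 1 m))) ⊆range
      (≤-reflexive (trans (length-range 1 m) (sym (trans (List.length-map _ (range 1 m)) (length-range 1 m)))))
    where
    injective : ∀ {x y} → x ∈ range 1 m → y ∈ range 1 m → posOf x π ≡ posOf y π → x ≡ y
    injective x∈ y∈ e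
      with _ , px , _ , atx ← posOf-∈ _ π (Perm.∈-resp-↭ (↭-sym π↭) x∈)
         | _ , py , _ , aty ← posOf-∈ _ π (Perm.∈-resp-↭ (↭-sym π↭) y∈) =
      trans (sym atx) (trans (cong (at π) (trans (sym px) (trans e py))) aty)
    ⊆range : ∀ {x} → x ∈ map (λ i → posOf i π) (range 1 m) → x ∈ range 1 m
    ⊆range x∈ with i , i∈ , refl ← ∈-map⁻ (λ i → posOf i π) x∈
              with j , p , j<n , _ ← posOf-∈ i π (Perm.∈-resp-↭ (↭-sym π↭) i∈) rewrite p =
      ∈-oneTo⁺ (subst (j <_) (IsPermutation⇒length π↭) j<n)

  posOf-inverse : ∀ j → j < m → posOf (suc j) (inverse π) ≡ at π (suc j)
  posOf-inverse j j<m with a , πj≡ , a<m ← IsPermutation-∈ π↭ (at-∈ π j (IsPermutation-<length π↭ j<m)) = begin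
    posOf (suc j) (inverse π)                  ≡⟨ cong (λ z → posOf z (inverse π)) inverse-at ⟨
    posOf (at (inverse π) (suc a)) (inverse π) ≡⟨ posOf-at (inverse π) a (IsPermutation⇒Unique inverse-IsPermutation)
                                                    (IsPermutation-<length inverse-IsPermutation a<m) ⟩
    suc a                                      ≡⟨ πj≡ ⟨
    at π (suc j)                               ∎
    where
    open ≡-Reasoning
    inverse-at : at (inverse π) (suc a) ≡ suc j
    inverse-at = trans (at-inverse a a<m) (trans (cong (λ z → posOf z π) (sym πj≡))
                   (posOf-at π j (IsPermutation⇒Unique π↭) (IsPermutation-<length π↭ j<m)))

-- inv π⁻¹ = inv π: both count the pairs of values a < b with b placed before a

invertedPair : List ℕ → ℕ → ℕ → ℕ
invertedPair w a b = indicator ((a <ᵇ b) ∧ (posOf b w <ᵇ posOf a w))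

invertedPairs : List ℕ → List ℕ → ℕ
invertedPairs L w = sum (map (λ a → sum (map (invertedPair w a) L)) L)

inv≡invertedPairs : ∀ w → Unique w → inv w ≡ invertedPairs w w
inv≡invertedPairs []       _        = refl
inv≡invertedPairs (x ∷ xs) (x∉ ∷ u) = sym (begin
    invertedPairs w w
  ≡⟨⟩
    (invertedPair w x x + sum (map (invertedPair w x) xs)) + sum (map pairs-from xs)
  ≡⟨ cong₂ (λ p q → (p + q) + sum (map pairs-from xs)) x-x x-xs ⟩
    sum (map pairs-from xs)
  ≡⟨ sum-map-cong _ _ xs (λ c∈ → cong₂ _+_ (c-x c∈) (sum-map-cong _ _ xs (c-b c∈))) ⟩
    sum (map (λ c → indicator (c <ᵇ x) + sum (map (invertedPair xs c) xs)) xs)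
  ≡⟨ sum-map-+ _ _ xs ⟩
    sum (map (λ c → indicator (c <ᵇ x)) xs) + invertedPairs xs xs
  ≡⟨ cong₂ _+_ (countB≡sum-indicator (_<ᵇ x) xs) (inv≡invertedPairs xs u) ⟨
    inv w ∎)
  where
  open ≡-Reasoning
  w = x ∷ xs
  pairs-from : ℕ → ℕ
  pairs-from c = invertedPair w c x + sum (map (invertedPair w c) xs)
  x-x : invertedPair w x x ≡ 0
  x-x rewrite ≮⇒<ᵇ≡false (<-irrefl {x} refl) = refl
  x-xs : sum (map (invertedPair w x) xs) ≡ 0
  x-xs = trans (sum-map-cong _ (λ _ → 0) xs x-b) (trans (sum-map-const 0 xs) (*-zeroʳ (length xs)))
    where
    x-b : ∀ {b} → b ∈ xs → invertedPair w x b ≡ 0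
    x-b b∈ rewrite posOf-there xs (All.lookup x∉ b∈) | posOf-here x xs = cong indicator (∧-zeroʳ _)
  c-x : ∀ {c} → c ∈ xs → invertedPair w c x ≡ indicator (c <ᵇ x)
  c-x {c} c∈ with j , p , _ ← posOf-∈ c xs c∈
    rewrite posOf-there xs (All.lookup x∉ c∈) | posOf-here x xs | p = cong indicator (∧-identityʳ _)
  c-b : ∀ {c} → c ∈ xs → ∀ {b} → b ∈ xs → invertedPair w c b ≡ invertedPair xs c b
  c-b c∈ b∈ rewrite posOf-there xs (All.lookup x∉ c∈) | posOf-there xs (All.lookup x∉ b∈) = refl

invertedPairs-↭ : ∀ {L L′} w → L ↭ L′ → invertedPairs L w ≡ invertedPairs L′ w
invertedPairs-↭ {L} {L′} w q = trans (sum-map-↭ (λ a → sum (map (invertedPair w a) L)) q)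
                                     (sum-map-cong _ _ L′ (λ _ → sum-map-↭ (invertedPair w _) q))

inv-inverse : ∀ {m π} → IsPermutation m π → inv (inverse π) ≡ inv π
inv-inverse {m} {π} π↭ = begin
    inv (inverse π)
  ≡⟨ inv≡invertedPairs (inverse π) (IsPermutation⇒Unique π⁻¹↭) ⟩
    invertedPairs (inverse π) (inverse π)
  ≡⟨ invertedPairs-↭ (inverse π) π⁻¹↭ ⟩
    invertedPairs [m] (inverse π)
  ≡⟨ sum-map-cong _ _ [m] (λ a∈ → sum-map-cong _ _ [m] (λ b∈ → by-values a∈ b∈)) ⟩
    sum (map (λ a → sum (map (inverted a) [m])) [m])
  ≡⟨ sum-map-comm inverted [m] [m] ⟩
    sum (map (λ i → sum (map (λ j → inverted j i) [m])) [m])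
  ≡⟨ sum-map-cong _ _ [m] (λ i∈ → sum-map-cong _ _ [m] (λ j∈ → by-positions i∈ j∈)) ⟨
    sum (map (λ i → sum (map (λ j → invertedPair π (at π i) (at π j)) [m])) [m])
  ≡⟨ sum-map-cong _ _ [m] (λ _ → cong sum (List.map-∘ [m])) ⟩
    sum (map (λ i → sum (map (invertedPair π (at π i)) (map (at π) [m]))) [m])
  ≡⟨ cong sum (List.map-∘ [m]) ⟩
    invertedPairs (map (at π) [m]) π
  ≡⟨ cong (λ L → invertedPairs L π) π≡ ⟨
    invertedPairs π π
  ≡⟨ inv≡invertedPairs π (IsPermutation⇒Unique π↭) ⟨
    inv π ∎
  where
  open ≡-Reasoning
  [m] = range 1 m
  π⁻¹↭ = inverse-IsPermutation π↭
  π≡ : π ≡ map (at π) [m]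
  π≡ = trans (≡map-at π) (cong (λ k → map (at π) (range 1 k)) (IsPermutation⇒length π↭))
  inverted : ℕ → ℕ → ℕ
  inverted a b = indicator ((a <ᵇ b) ∧ (at π b <ᵇ at π a))
  by-values : ∀ {a b} → a ∈ [m] → b ∈ [m] → invertedPair (inverse π) a b ≡ inverted a b
  by-values a∈ b∈ with ja , refl , ja<m ← ∈-oneTo⁻ a∈ | jb , refl , jb<m ← ∈-oneTo⁻ b∈
    rewrite posOf-inverse π↭ ja ja<m | posOf-inverse π↭ jb jb<m = refl
  by-positions : ∀ {i j} → i ∈ [m] → j ∈ [m] → invertedPair π (at π i) (at π j) ≡ inverted j i
  by-positions i∈ j∈ with ji , refl , ji<m ← ∈-oneTo⁻ i∈ | jj , refl , jj<m ← ∈-oneTo⁻ j∈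
    rewrite posOf-at π ji (IsPermutation⇒Unique π↭) (IsPermutation-<length π↭ ji<m)
          | posOf-at π jj (IsPermutation⇒Unique π↭) (IsPermutation-<length π↭ jj<m) =
    cong indicator (∧-comm (at π (suc ji) <ᵇ at π (suc jj)) (suc jj <ᵇ suc ji))

PreservesOrderOn : (ℕ → ℕ) → List ℕ → Set
PreservesOrderOn f w = ∀ {x y} → x ∈ w → y ∈ w → (f y <ᵇ f x) ≡ (y <ᵇ x)

decRun-map : ∀ f w → PreservesOrderOn f w → decRun (map f w) ≡ decRun w
decRun-map f []           _ = refl
decRun-map f (x ∷ [])     _ = refl
decRun-map f (x ∷ y ∷ ys) h = cong₂ (λ b r → if b then suc r else 1)
  (h (here refl) (there (here refl))) (decRun-map f (y ∷ ys) (λ a b → h (there a) (there b)))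

isDesarr-map : ∀ f w → PreservesOrderOn f w → isDesarr (map f w) ≡ isDesarr w
isDesarr-map f []       _ = refl
isDesarr-map f (x ∷ xs) h = cong even (decRun-map f (x ∷ xs) h)

inv-map : ∀ f w → PreservesOrderOn f w → inv (map f w) ≡ inv w
inv-map f []       _ = refl
inv-map f (x ∷ xs) h = cong₂ _+_
  (trans (countB-map (_<ᵇ f x) f xs) (countB-cong _ _ xs (h (here refl) ∘ there)))
  (inv-map f xs (λ a b → h (there a) (there b)))

module RelabelByAscending {m τ} xs (asc : AllPairs _<_ xs) (len : length xs ≡ m) (τ↭ : IsPermutation m τ) where

  at-preservesOrder : PreservesOrderOn (at xs) τ
  at-preservesOrder x∈ y∈
    with i , refl , i<m ← IsPermutation-∈ τ↭ x∈ | j , refl , j<m ← IsPermutation-∈ τ↭ y∈ =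
    <ᵇ-cong-⇔ (λ xj<xi → s≤s (≰⇒> λ i≤j → <⇒≱ xj<xi (at-monotone i≤j (<length j<m))))
              (λ { (s≤s j<i) → at-ascending xs asc j<i (<length i<m) })
    where
    <length : ∀ {k} → k < m → k < length xs
    <length = subst (_ <_) (sym len)
    at-monotone : ∀ {i j} → i ≤ j → j < length xs → at xs (suc i) ≤ at xs (suc j)
    at-monotone {i} {j} i≤j j<n with i ≟ j
    ... | yes refl = ≤-refl
    ... | no  i≢j  = <⇒≤ (at-ascending xs asc (≤∧≢⇒< i≤j i≢j) j<n)

  map-at-↭ : map (at xs) τ ↭ xs
  map-at-↭ = ↭-trans (Perm.map⁺ (at xs) τ↭)
               (↭-reflexive (sym (trans (≡map-at xs) (cong (λ k → map (at xs) (range 1 k)) len))))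

countB-<-mono : ∀ w {y x} → y ≤ x → countB (_<ᵇ y) w ≤ countB (_<ᵇ x) w
countB-<-mono []       y≤x = z≤n
countB-<-mono (z ∷ zs) {y} {x} y≤x with z <ᵇ y in e₁ | z <ᵇ x in e₂
... | true  | true  = s≤s (countB-<-mono zs y≤x)
... | true  | false = ⊥-elim (<ᵇ≡false⇒≮ e₂ (<-≤-trans (<ᵇ≡true⇒< e₁) y≤x))
... | false | true  = m≤n⇒m≤1+n (countB-<-mono zs y≤x)
... | false | false = countB-<-mono zs y≤x

countB-<-strictMono : ∀ w {y x} → y ∈ w → y < x → countB (_<ᵇ y) w < countB (_<ᵇ x) w
countB-<-strictMono (z ∷ zs) {y} {x} (here refl) y<x
  rewrite ≮⇒<ᵇ≡false (<-irrefl {z} refl) | <⇒<ᵇ≡true y<x = s≤s (countB-<-mono zs (<⇒≤ y<x))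
countB-<-strictMono (z ∷ zs) {y} {x} (there m) y<x with z <ᵇ y in e₁ | z <ᵇ x in e₂
... | true  | true  = s≤s (countB-<-strictMono zs m y<x)
... | true  | false = ⊥-elim (<ᵇ≡false⇒≮ e₂ (<-trans (<ᵇ≡true⇒< e₁) y<x))
... | false | true  = m≤n⇒m≤1+n (countB-<-strictMono zs m y<x)
... | false | false = countB-<-strictMono zs m y<x

rank : List ℕ → ℕ → ℕ
rank w y = suc (countB (_<ᵇ y) w)

rank-preservesOrder : ∀ w → PreservesOrderOn (rank w) w
rank-preservesOrder w {x} {y} x∈ y∈ =
  <ᵇ-cong-⇔ {c = y} {d = x} (λ rx<ry → ≰⇒> λ x≤y → <⇒≱ rx<ry (s≤s (countB-<-mono w x≤y)))
                            (s≤s ∘ countB-<-strictMono w y∈)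

standardize-IsPermutation : ∀ w → Unique w → IsPermutation (length w) (standardize w)
standardize-IsPermutation w u = Unique-⊆-length⇒↭ (map (rank w) w) (range 1 (length w))
  (Unique-map⁺ (rank w) injective u) ⊆range
  (≤-reflexive (trans (length-range 1 (length w)) (sym (List.length-map (rank w) w))))
  where
  injective : ∀ {x y} → x ∈ w → y ∈ w → rank w x ≡ rank w y → x ≡ y
  injective {x} {y} x∈ y∈ e with <-cmp x y
  ... | tri≈ _ x≡y _ = x≡y
  ... | tri< x<y _ _ = ⊥-elim (<-irrefl e (<ᵇ≡true⇒< (trans (rank-preservesOrder w y∈ x∈) (<⇒<ᵇ≡true x<y))))
  ... | tri> _ _ y<x =
    ⊥-elim (<-irrefl (sym e) (<ᵇ≡true⇒< (trans (rank-preservesOrder w x∈ y∈) (<⇒<ᵇ≡true y<x))))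
  ⊆range : ∀ {z} → z ∈ map (rank w) w → z ∈ range 1 (length w)
  ⊆range z∈ with y , y∈ , refl ← ∈-map⁻ (rank w) z∈ =
    ∈-oneTo⁺ (countB<length _ y∈ (≮⇒<ᵇ≡false (<-irrefl {y} refl)))

cross : List ℕ → List ℕ → ℕ
cross xs ys = sum (map (λ x → countB (_<ᵇ x) ys) xs)

inv-++ : ∀ xs ys → inv (xs ++ ys) ≡ inv xs + inv ys + cross xs ys
inv-++ []       ys = sym (+-identityʳ (inv ys))
inv-++ (x ∷ xs) ys rewrite countB-++ (_<ᵇ x) xs ys | inv-++ xs ys =
  lemma (countB (_<ᵇ x) xs) (countB (_<ᵇ x) ys) (inv xs) (inv ys) (cross xs ys)
  where
  lemma : ∀ a b c d e → a + b + (c + d + e) ≡ a + c + d + (b + e)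
  lemma = solve-∀

cross-↭ʳ : ∀ xs {ys ys′} → ys ↭ ys′ → cross xs ys ≡ cross xs ys′
cross-↭ʳ xs q = sum-map-cong _ _ xs (λ _ → countB-↭ _ q)

cross-∷ʳ : ∀ xs a zs → cross xs (a ∷ zs) ≡ countB (a <ᵇ_) xs + cross xs zs
cross-∷ʳ xs a zs = begin
  cross xs (a ∷ zs)                                           ≡⟨ sum-map-cong _ _ xs (λ _ → countB-∷ _ a zs) ⟩
  sum (map (λ x → indicator (a <ᵇ x) + countB (_<ᵇ x) zs) xs) ≡⟨ sum-map-+ _ _ xs ⟩
  sum (map (indicator ∘ (a <ᵇ_)) xs) + cross xs zs            ≡⟨ cong (_+ cross xs zs) (countB≡sum-indicator _ xs) ⟨
  countB (a <ᵇ_) xs + cross xs zs                             ∎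
  where open ≡-Reasoning

inv-∷ʳ : ∀ ys x → inv (ys ++ (x ∷ [])) ≡ inv ys + countB (x <ᵇ_) ys
inv-∷ʳ ys x = begin
  inv (ys ++ (x ∷ []))                  ≡⟨ inv-++ ys (x ∷ []) ⟩
  inv ys + 0 + cross ys (x ∷ [])        ≡⟨ cong₂ _+_ (+-identityʳ (inv ys)) (cross-∷ʳ ys x []) ⟩
  inv ys + (countB (x <ᵇ_) ys + cross ys []) ≡⟨ cong (λ c → inv ys + (countB (x <ᵇ_) ys + c)) cross-[] ⟩
  inv ys + (countB (x <ᵇ_) ys + 0)      ≡⟨ cong (inv ys +_) (+-identityʳ _) ⟩
  inv ys + countB (x <ᵇ_) ys            ∎
  where
  open ≡-Reasoning
  cross-[] : cross ys [] ≡ 0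
  cross-[] = trans (sum-map-const 0 ys) (*-zeroʳ (length ys))

inv-move-to-front : ∀ ys a zs →
  inv (ys ++ a ∷ zs) + countB (_<ᵇ a) ys ≡ inv (a ∷ ys ++ zs) + countB (a <ᵇ_) ys
inv-move-to-front ys a zs = begin
    inv (ys ++ a ∷ zs) + countB (_<ᵇ a) ys
  ≡⟨ cong (_+ countB (_<ᵇ a) ys)
          (trans (inv-++ ys (a ∷ zs)) (cong (inv ys + inv (a ∷ zs) +_) (cross-∷ʳ ys a zs))) ⟩
    inv ys + (countB (_<ᵇ a) zs + inv zs) + (countB (a <ᵇ_) ys + cross ys zs) + countB (_<ᵇ a) ys
  ≡⟨ lemma (inv ys) (countB (_<ᵇ a) zs) (inv zs) (countB (a <ᵇ_) ys) (cross ys zs) (countB (_<ᵇ a) ys) ⟩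
    countB (_<ᵇ a) ys + countB (_<ᵇ a) zs + (inv ys + inv zs + cross ys zs) + countB (a <ᵇ_) ys
  ≡⟨ cong₂ (λ c i → c + i + countB (a <ᵇ_) ys) (countB-++ (_<ᵇ a) ys zs) (inv-++ ys zs) ⟨
    inv (a ∷ ys ++ zs) + countB (a <ᵇ_) ys ∎
  where
  open ≡-Reasoning
  lemma : ∀ i c j d x e → i + (c + j) + (d + x) + e ≡ e + c + (i + j + x) + d
  lemma = solve-∀

inv-ascending : ∀ {xs} → AllPairs _<_ xs → inv xs ≡ 0
inv-ascending {[]}     []          = refl
inv-ascending {x ∷ xs} (x< ∷ asc) rewrite inv-ascending asc =
  trans (+-identityʳ _) (countB-none _ (All.map (λ x<y → ≮⇒<ᵇ≡false (<⇒≯ x<y)) x<))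

-- Foata's transformation: inv ∘ F2 = maj

reverse-∷-++ : ∀ (a : ℕ) acc l → reverse (a ∷ acc) ++ l ≡ reverse acc ++ a ∷ l
reverse-∷-++ a acc l = trans (cong (_++ l) (List.unfold-reverse a acc)) (List.++-assoc (reverse acc) (a ∷ []) l)

All-reverse : ∀ {P : ℕ → Set} xs → All P xs → All P (reverse xs)
All-reverse xs = Perm.All-resp-↭ (↭-sym (Perm.↭-reverse xs))

shiftBy-↭ : ∀ p acc l → shiftBy p acc l ↭ reverse acc ++ l
shiftBy-↭ p acc []      = ↭-reflexive (sym (List.++-identityʳ (reverse acc)))
shiftBy-↭ p acc (a ∷ l) with p a
... | true  = ↭-trans (↭-prep a (Perm.++⁺ˡ (reverse acc) (shiftBy-↭ p [] l))) (↭-sym (Perm.shift a (reverse acc) l))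
... | false = ↭-trans (shiftBy-↭ p (a ∷ acc) l) (↭-reflexive (reverse-∷-++ a acc l))

-- the pending compartment acc ++ l is empty or is closed by a letter satisfying p,
-- so that shiftBy really rotates every compartment
data Closed (p : ℕ → Bool) : List ℕ → List ℕ → Set where
  empty  : Closed p [] []
  closed : ∀ {acc l b} → lastL l ≡ just b → p b ≡ true → Closed p acc l

Closed-cut : ∀ {p a acc} l → p a ≡ true → Closed p acc (a ∷ l) → Closed p [] l
Closed-cut []      _ _              = empty
Closed-cut (c ∷ l) _ (closed e pb) = closed e pb

Closed-push : ∀ {p a acc} l → p a ≡ false → Closed p acc (a ∷ l) → Closed p (a ∷ acc) l
Closed-push []      pa (closed refl pb) = contradiction (trans (sym pb) pa) λ ()
Closed-push (c ∷ l) _  (closed e pb)    = closed e pb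

-- cutting after the letters ≤ x, each rotation removes one inversion per letter > x
inv-shiftBy-≤ : ∀ x acc l → All (x <_) acc → Closed (_≤ᵇ x) acc l →
  inv (reverse acc ++ l) ≡ inv (shiftBy (_≤ᵇ x) acc l) + length acc + countB (not ∘ (_≤ᵇ x)) l
inv-shiftBy-≤ x []  []      _   empty        = refl
inv-shiftBy-≤ x acc []      _   (closed () _)
inv-shiftBy-≤ x acc (a ∷ l) acc>x c with a ≤ᵇ x in a≤x
... | true = begin
    inv (reverse acc ++ a ∷ l)
  ≡⟨ sym (+-identityʳ _) ⟩
    inv (reverse acc ++ a ∷ l) + 0
  ≡⟨ cong (inv (reverse acc ++ a ∷ l) +_) (countB-none (_<ᵇ a) (All-reverse acc
       (All.map (λ x<c → ≮⇒<ᵇ≡false {n = a} (<⇒≯ (≤-<-trans (≤ᵇ≡true⇒≤ a≤x) x<c))) acc>x))) ⟨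
    inv (reverse acc ++ a ∷ l) + countB (_<ᵇ a) (reverse acc)
  ≡⟨ inv-move-to-front (reverse acc) a l ⟩
    inv (a ∷ reverse acc ++ l) + countB (a <ᵇ_) (reverse acc)
  ≡⟨ cong₂ _+_ (inv-++ (a ∷ reverse acc) l)
               (countB-all (a <ᵇ_) (All-reverse acc
                 (All.map (λ x<c → <⇒<ᵇ≡true (≤-<-trans (≤ᵇ≡true⇒≤ a≤x) x<c)) acc>x))) ⟩
    inv (a ∷ reverse acc) + inv l + cross (a ∷ reverse acc) l + length (reverse acc)
  ≡⟨ cong₂ (λ u v → inv (a ∷ reverse acc) + u + v + length (reverse acc))
           (inv-shiftBy-≤ x [] l [] (Closed-cut l a≤x c))
           (cross-↭ʳ (a ∷ reverse acc) (↭-sym (shiftBy-↭ (_≤ᵇ x) [] l))) ⟩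
    inv (a ∷ reverse acc) + (inv sh + 0 + countB q l) + cross (a ∷ reverse acc) sh + length (reverse acc)
  ≡⟨ lemma (inv (a ∷ reverse acc)) (inv sh) (countB q l) (cross (a ∷ reverse acc) sh) (length (reverse acc)) ⟩
    inv (a ∷ reverse acc) + inv sh + cross (a ∷ reverse acc) sh + length (reverse acc) + countB q l
  ≡⟨ cong₂ (λ u v → u + v + countB q l) (inv-++ (a ∷ reverse acc) sh) (sym (List.length-reverse acc)) ⟨
    inv ((a ∷ reverse acc) ++ sh) + length acc + countB q l ∎
  where
  open ≡-Reasoning
  q = not ∘ (_≤ᵇ x)
  sh = shiftBy (_≤ᵇ x) [] l
  lemma : ∀ a b c d e → a + (b + 0 + c) + d + e ≡ a + b + d + e + c
  lemma = solve-∀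
... | false = begin
    inv (reverse acc ++ a ∷ l)
  ≡⟨ cong inv (reverse-∷-++ a acc l) ⟨
    inv (reverse (a ∷ acc) ++ l)
  ≡⟨ inv-shiftBy-≤ x (a ∷ acc) l (≤ᵇ≡false⇒> a≤x ∷ acc>x) (Closed-push l a≤x c) ⟩
    inv (shiftBy (_≤ᵇ x) (a ∷ acc) l) + suc (length acc) + countB (not ∘ (_≤ᵇ x)) l
  ≡⟨ lemma (inv (shiftBy (_≤ᵇ x) (a ∷ acc) l)) (length acc) (countB (not ∘ (_≤ᵇ x)) l) ⟩
    inv (shiftBy (_≤ᵇ x) (a ∷ acc) l) + length acc + suc (countB (not ∘ (_≤ᵇ x)) l) ∎
  where
  open ≡-Reasoning
  lemma : ∀ a b c → a + suc b + c ≡ a + b + suc c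
  lemma = solve-∀

-- cutting after the letters > x, each rotation adds one inversion per letter ≤ x
inv-shiftBy-> : ∀ x acc l → All (_≤ x) acc → Closed (not ∘ (_≤ᵇ x)) acc l →
  inv (shiftBy (not ∘ (_≤ᵇ x)) acc l) ≡ inv (reverse acc ++ l) + length acc + countB (_≤ᵇ x) l
inv-shiftBy-> x []  []      _    empty        = refl
inv-shiftBy-> x acc []      _    (closed () _)
inv-shiftBy-> x acc (a ∷ l) acc≤x c with a ≤ᵇ x in a≤x
... | false = sym (begin
    inv (reverse acc ++ a ∷ l) + length acc + countB (_≤ᵇ x) l
  ≡⟨ cong (λ u → inv (reverse acc ++ a ∷ l) + u + countB (_≤ᵇ x) l)
          (trans (countB-all (_<ᵇ a) (All-reverse acc (All.map (λ c≤x → <⇒<ᵇ≡true (≤-<-trans c≤x x<a)) acc≤x)))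
                 (List.length-reverse acc)) ⟨
    inv (reverse acc ++ a ∷ l) + countB (_<ᵇ a) (reverse acc) + countB (_≤ᵇ x) l
  ≡⟨ cong (_+ countB (_≤ᵇ x) l) (inv-move-to-front (reverse acc) a l) ⟩
    inv (a ∷ reverse acc ++ l) + countB (a <ᵇ_) (reverse acc) + countB (_≤ᵇ x) l
  ≡⟨ cong₂ (λ u v → u + v + countB (_≤ᵇ x) l) (inv-++ (a ∷ reverse acc) l)
           (countB-none (a <ᵇ_) (All-reverse acc
             (All.map (λ c≤x → ≮⇒<ᵇ≡false (<⇒≯ (≤-<-trans c≤x x<a))) acc≤x))) ⟩
    inv (a ∷ reverse acc) + inv l + cross (a ∷ reverse acc) l + 0 + countB (_≤ᵇ x) l
  ≡⟨ cong (λ v → inv (a ∷ reverse acc) + inv l + v + 0 + countB (_≤ᵇ x) l)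
          (cross-↭ʳ (a ∷ reverse acc) (↭-sym (shiftBy-↭ p [] l))) ⟩
    inv (a ∷ reverse acc) + inv l + cross (a ∷ reverse acc) sh + 0 + countB (_≤ᵇ x) l
  ≡⟨ lemma (inv (a ∷ reverse acc)) (inv l) (cross (a ∷ reverse acc) sh) (countB (_≤ᵇ x) l) ⟩
    inv (a ∷ reverse acc) + (inv l + 0 + countB (_≤ᵇ x) l) + cross (a ∷ reverse acc) sh
  ≡⟨ cong (λ u → inv (a ∷ reverse acc) + u + cross (a ∷ reverse acc) sh)
          (inv-shiftBy-> x [] l [] (Closed-cut l (cong not a≤x) c)) ⟨
    inv (a ∷ reverse acc) + inv sh + cross (a ∷ reverse acc) sh
  ≡⟨ inv-++ (a ∷ reverse acc) sh ⟨
    inv ((a ∷ reverse acc) ++ sh) ∎)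
  where
  open ≡-Reasoning
  p = not ∘ (_≤ᵇ x)
  sh = shiftBy p [] l
  x<a : x < a
  x<a = ≤ᵇ≡false⇒> a≤x
  lemma : ∀ a b c d → a + b + c + 0 + d ≡ a + (b + 0 + d) + c
  lemma = solve-∀
... | true = begin
    inv (shiftBy (not ∘ (_≤ᵇ x)) (a ∷ acc) l)
  ≡⟨ inv-shiftBy-> x (a ∷ acc) l (≤ᵇ≡true⇒≤ a≤x ∷ acc≤x) (Closed-push l (cong not a≤x) c) ⟩
    inv (reverse (a ∷ acc) ++ l) + suc (length acc) + countB (_≤ᵇ x) l
  ≡⟨ cong (λ u → inv u + suc (length acc) + countB (_≤ᵇ x) l) (reverse-∷-++ a acc l) ⟩
    inv (reverse acc ++ a ∷ l) + suc (length acc) + countB (_≤ᵇ x) l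
  ≡⟨ lemma (inv (reverse acc ++ a ∷ l)) (length acc) (countB (_≤ᵇ x) l) ⟩
    inv (reverse acc ++ a ∷ l) + length acc + suc (countB (_≤ᵇ x) l) ∎
  where
  open ≡-Reasoning
  lemma : ∀ a b c → a + suc b + c ≡ a + b + suc c
  lemma = solve-∀

∷ʳ-induction : (P : List ℕ → Set) → P [] → (∀ w x → P w → P (w ++ (x ∷ []))) → ∀ w → P w
∷ʳ-induction P base step w = subst P (List.reverse-involutive w) (go (reverse w))
  where
  go : ∀ r → P (reverse r)
  go []      = base
  go (x ∷ r) = subst P (sym (List.unfold-reverse x r)) (step (reverse r) x (go r))

F2-∷ʳ : ∀ w x → F2 (w ++ (x ∷ [])) ≡ foataStep (F2 w) x
F2-∷ʳ w x = List.foldl-∷ʳ foataStep [] x w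

lastOr : ℕ → List ℕ → ℕ
lastOr y []       = y
lastOr y (z ∷ zs) = lastOr z zs

lastL-∷ : ∀ y ys → lastL (y ∷ ys) ≡ just (lastOr y ys)
lastL-∷ y []       = refl
lastL-∷ y (z ∷ zs) = lastL-∷ z zs

lastL-∷ʳ : ∀ w x → lastL (w ++ (x ∷ [])) ≡ just x
lastL-∷ʳ []           x = refl
lastL-∷ʳ (y ∷ [])     x = refl
lastL-∷ʳ (y ∷ z ∷ zs) x = lastL-∷ʳ (z ∷ zs) x

foataRotate : ℕ → ℕ → List ℕ → List ℕ
foataRotate l x γ = if l ≤ᵇ x then shiftBy (_≤ᵇ x) [] γ else shiftBy (not ∘ (_≤ᵇ x)) [] γ

foataStep-lastL : ∀ γ x {l} → lastL γ ≡ just l → foataStep γ x ≡ foataRotate l x γ ++ (x ∷ [])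
foataStep-lastL γ x e with lastL γ | e
... | just _ | refl = refl

foataRotate-↭ : ∀ l x γ → foataRotate l x γ ↭ γ
foataRotate-↭ l x γ with l ≤ᵇ x
... | true  = shiftBy-↭ _ [] γ
... | false = shiftBy-↭ _ [] γ

foataStep-↭ : ∀ γ x → foataStep γ x ↭ γ ++ (x ∷ [])
foataStep-↭ []       x = ↭-refl
foataStep-↭ (y ∷ ys) x = ↭-trans (↭-reflexive (foataStep-lastL (y ∷ ys) x (lastL-∷ y ys)))
                                (Perm.++⁺ʳ (x ∷ []) (foataRotate-↭ (lastOr y ys) x (y ∷ ys)))

lastL-foataStep : ∀ γ x → lastL (foataStep γ x) ≡ just x
lastL-foataStep []       x = refl
lastL-foataStep (y ∷ ys) x = trans (cong lastL (foataStep-lastL (y ∷ ys) x (lastL-∷ y ys)))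
                                   (lastL-∷ʳ (foataRotate (lastOr y ys) x (y ∷ ys)) x)

F2-↭ : ∀ w → F2 w ↭ w
F2-↭ = ∷ʳ-induction (λ w → F2 w ↭ w) ↭-refl λ w x ih →
  ↭-trans (↭-reflexive (F2-∷ʳ w x)) (↭-trans (foataStep-↭ (F2 w) x) (Perm.++⁺ʳ (x ∷ []) ih))

lastL-F2 : ∀ w → lastL (F2 w) ≡ lastL w
lastL-F2 = ∷ʳ-induction (λ w → lastL (F2 w) ≡ lastL w) refl λ w x _ →
  trans (cong lastL (F2-∷ʳ w x)) (trans (lastL-foataStep (F2 w) x) (sym (lastL-∷ʳ w x)))

inv-foataStep : ∀ γ x {l} → lastL γ ≡ just l → inv (foataStep γ x) ≡ inv γ + (if x <ᵇ l then length γ else 0)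
inv-foataStep γ x {l} e rewrite foataStep-lastL γ x e with l ≤ᵇ x in l≤x
... | true rewrite ≮⇒<ᵇ≡false {x} {l} (≤⇒≯ (≤ᵇ≡true⇒≤ l≤x)) = begin
    inv (sh ++ (x ∷ []))
  ≡⟨ inv-∷ʳ sh x ⟩
    inv sh + countB (x <ᵇ_) sh
  ≡⟨ cong (inv sh +_)
          (trans (countB-↭ _ (shiftBy-↭ _ [] γ)) (countB-cong _ _ γ (λ {c} _ → sym (not-≤ᵇ c x)))) ⟩
    inv sh + countB (not ∘ (_≤ᵇ x)) γ
  ≡⟨ cong (_+ countB (not ∘ (_≤ᵇ x)) γ) (+-identityʳ (inv sh)) ⟨
    inv sh + 0 + countB (not ∘ (_≤ᵇ x)) γ
  ≡⟨ inv-shiftBy-≤ x [] γ [] (closed e l≤x) ⟨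
    inv γ
  ≡⟨ +-identityʳ (inv γ) ⟨
    inv γ + 0 ∎
  where
  open ≡-Reasoning
  sh = shiftBy (_≤ᵇ x) [] γ
... | false rewrite <⇒<ᵇ≡true {x} {l} (≤ᵇ≡false⇒> l≤x) = begin
    inv (sh ++ (x ∷ []))
  ≡⟨ inv-∷ʳ sh x ⟩
    inv sh + countB (x <ᵇ_) sh
  ≡⟨ cong₂ _+_ (inv-shiftBy-> x [] γ [] (closed e (cong not l≤x)))
               (trans (countB-↭ _ (shiftBy-↭ _ [] γ)) (countB-cong _ _ γ (λ {c} _ → sym (not-≤ᵇ c x)))) ⟩
    inv γ + 0 + countB (_≤ᵇ x) γ + countB (not ∘ (_≤ᵇ x)) γ
  ≡⟨ lemma (inv γ) (countB (_≤ᵇ x) γ) (countB (not ∘ (_≤ᵇ x)) γ) ⟩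
    inv γ + (countB (_≤ᵇ x) γ + countB (not ∘ (_≤ᵇ x)) γ)
  ≡⟨ cong (inv γ +_) (countB-+-countB-not (_≤ᵇ x) γ) ⟩
    inv γ + length γ ∎
  where
  open ≡-Reasoning
  sh = shiftBy (not ∘ (_≤ᵇ x)) [] γ
  lemma : ∀ a b c → a + 0 + b + c ≡ a + (b + c)
  lemma = solve-∀

majFrom-∷ʳ : ∀ i y ys x →
  majFrom i (y ∷ ys ++ (x ∷ [])) ≡ majFrom i (y ∷ ys) + (if x <ᵇ lastOr y ys then i + length ys else 0)
majFrom-∷ʳ i y []       x with x <ᵇ y
... | true  = refl
... | false = refl
majFrom-∷ʳ i y (z ∷ zs) x rewrite majFrom-∷ʳ (suc i) z zs x with x <ᵇ lastOr z zs
... | true  = trans (sym (+-assoc (if z <ᵇ y then i else 0) _ _))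
                    (cong ((if z <ᵇ y then i else 0) + majFrom (suc i) (z ∷ zs) +_) (sym (+-suc i (length zs))))
... | false = sym (+-assoc (if z <ᵇ y then i else 0) _ _)

inv-F2 : ∀ w → inv (F2 w) ≡ maj w
inv-F2 = ∷ʳ-induction (λ w → inv (F2 w) ≡ maj w) refl step
  where
  step : ∀ w x → inv (F2 w) ≡ maj w → inv (F2 (w ++ (x ∷ []))) ≡ maj (w ++ (x ∷ []))
  step []       x _  = refl
  step (y ∷ ys) x ih = begin
      inv (F2 (y ∷ ys ++ (x ∷ [])))
    ≡⟨ cong inv (F2-∷ʳ (y ∷ ys) x) ⟩
      inv (foataStep (F2 (y ∷ ys)) x)
    ≡⟨ inv-foataStep (F2 (y ∷ ys)) x (trans (lastL-F2 (y ∷ ys)) (lastL-∷ y ys)) ⟩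
      inv (F2 (y ∷ ys)) + (if x <ᵇ lastOr y ys then length (F2 (y ∷ ys)) else 0)
    ≡⟨ cong₂ (λ u v → u + (if x <ᵇ lastOr y ys then v else 0)) ih (Perm.↭-length (F2-↭ (y ∷ ys))) ⟩
      maj (y ∷ ys) + (if x <ᵇ lastOr y ys then suc (length ys) else 0)
    ≡⟨ majFrom-∷ʳ 1 y ys x ⟨
      maj (y ∷ ys ++ (x ∷ [])) ∎
    where open ≡-Reasoning

-- F2 keeps the relative order of two letters that no other letter separates

filterB-↭ : ∀ p {xs ys} → xs ↭ ys → filterB p xs ↭ filterB p ys
filterB-↭ p ↭.refl = ↭-refl
filterB-↭ p (↭.prep x q) with p x
... | true  = ↭-prep x (filterB-↭ p q)
... | false = filterB-↭ p q
filterB-↭ p (↭.swap x y q) with p x | p y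
... | true  | true  = ↭-swap x y (filterB-↭ p q)
... | true  | false = ↭-prep x (filterB-↭ p q)
... | false | true  = ↭-prep y (filterB-↭ p q)
... | false | false = filterB-↭ p q
filterB-↭ p (↭.trans q r) = ↭-trans (filterB-↭ p q) (filterB-↭ p r)

filterB-++ : ∀ p xs ys → filterB p (xs ++ ys) ≡ filterB p xs ++ filterB p ys
filterB-++ p []       ys = refl
filterB-++ p (x ∷ xs) ys with p x
... | true  = cong (x ∷_) (filterB-++ p xs ys)
... | false = filterB-++ p xs ys

filterB-all : ∀ p {xs} → All (λ x → p x ≡ true) xs → filterB p xs ≡ xs
filterB-all p []         = refl
filterB-all p (px ∷ pxs) rewrite px = cong (_ ∷_) (filterB-all p pxs)

filterB-none : ∀ p {xs} → All (λ x → p x ≡ false) xs → filterB p xs ≡ []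
filterB-none p []         = refl
filterB-none p (px ∷ pxs) rewrite px = filterB-none p pxs

filterB-⊆ : ∀ p xs {y} → y ∈ filterB p xs → y ∈ xs
filterB-⊆ p (x ∷ xs) m with p x
filterB-⊆ p (x ∷ xs) (here refl) | true  = here refl
filterB-⊆ p (x ∷ xs) (there m)   | true  = there (filterB-⊆ p xs m)
filterB-⊆ p (x ∷ xs) m           | false = there (filterB-⊆ p xs m)

filterB-ascending : ∀ p {xs} → AllPairs _<_ xs → AllPairs _<_ (filterB p xs)
filterB-ascending p {[]}     []         = []
filterB-ascending p {x ∷ xs} (x< ∷ asc) with p x
... | true  = All.tabulate (All.lookup x< ∘ filterB-⊆ p xs) ∷ filterB-ascending p asc
... | false = filterB-ascending p asc

before : ℕ → ℕ → List ℕ → Bool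
before b a []       = false
before b a (x ∷ xs) = if x ≡ᵇ a then false else (if x ≡ᵇ b then true else before b a xs)

before-++-∉ : ∀ {a b} u v → a ∉ u → b ∉ u → before b a (u ++ v) ≡ before b a v
before-++-∉ []      v _   _   = refl
before-++-∉ (x ∷ u) v a∉ b∉
  rewrite ≢⇒≡ᵇ≡false (a∉ ∘ here ∘ sym) | ≢⇒≡ᵇ≡false (b∉ ∘ here ∘ sym) =
  before-++-∉ u v (a∉ ∘ there) (b∉ ∘ there)

before-++-∉-∈ : ∀ {a b} u v → a ∉ u → b ∈ u → before b a (u ++ v) ≡ true
before-++-∉-∈ {a} {b} (x ∷ u) v a∉ b∈ rewrite ≢⇒≡ᵇ≡false (a∉ ∘ here ∘ sym) with x ≡ᵇ b in e | b∈
... | true  | _         = refl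
... | false | here refl = contradiction (trans (sym (≡⇒≡ᵇ≡true {x} refl)) e) λ ()
... | false | there b∈′ = before-++-∉-∈ u v (a∉ ∘ there) b∈′

before-++-∈-∉ : ∀ {a b} u v → a ∈ u → b ∉ u → before b a (u ++ v) ≡ false
before-++-∈-∉ {a} {b} (x ∷ u) v a∈ b∉ with x ≡ᵇ a in e | a∈
... | true  | _         = refl
... | false | here refl = contradiction (trans (sym (≡⇒≡ᵇ≡true {x} refl)) e) λ ()
... | false | there a∈′ rewrite ≢⇒≡ᵇ≡false (b∉ ∘ here ∘ sym) = before-++-∈-∉ u v a∈′ (b∉ ∘ there)

before-++ : ∀ {a b} u v → a ∈ u ⊎ b ∈ u → before b a (u ++ v) ≡ before b a u
before-++ []      v (inj₁ ())
before-++ []      v (inj₂ ())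
before-++ {a} {b} (x ∷ u) v a∨b with x ≡ᵇ a in ea
... | true = refl
... | false with x ≡ᵇ b in eb
...   | true  = refl
...   | false = before-++ u v (tail a∨b)
  where
  tail : a ∈ x ∷ u ⊎ b ∈ x ∷ u → a ∈ u ⊎ b ∈ u
  tail (inj₁ (here refl)) = contradiction (trans (sym (≡⇒≡ᵇ≡true {x} refl)) ea) λ ()
  tail (inj₁ (there a∈))  = inj₁ a∈
  tail (inj₂ (here refl)) = contradiction (trans (sym (≡⇒≡ᵇ≡true {x} refl)) eb) λ ()
  tail (inj₂ (there b∈))  = inj₂ b∈

posOf<ᵇposOf≡before : ∀ {a b} w → a ≢ b → a ∈ w → b ∈ w → (posOf b w <ᵇ posOf a w) ≡ before b a w
posOf<ᵇposOf≡before {a} {b} (x ∷ xs) a≢b a∈ b∈ with x ≡ᵇ a in ea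
... | true rewrite ≢⇒≡ᵇ≡false {x} {b} (a≢b ∘ trans (sym (≡ᵇ≡true⇒≡ ea))) = refl
... | false with x ≡ᵇ b in eb | a∈ | b∈
...   | _     | here refl | _ = contradiction (trans (sym (≡⇒≡ᵇ≡true {x} refl)) ea) λ ()
...   | true  | there a∈′ | _ with _ , p , _ ← posOf-∈ a xs a∈′ rewrite p = refl
...   | false | there _   | here refl = contradiction (trans (sym (≡⇒≡ᵇ≡true {x} refl)) eb) λ ()
...   | false | there a∈′ | there b∈′ = posOf<ᵇposOf≡before xs a≢b a∈′ b∈′

before-filterB : ∀ p {a b} w → p a ≡ true → p b ≡ true → before b a (filterB p w) ≡ before b a w
before-filterB p         []       _  _  = refl
before-filterB p {a} {b} (x ∷ xs) pa pb with p x in px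
... | true  = cong (λ r → if x ≡ᵇ a then false else (if x ≡ᵇ b then true else r)) (before-filterB p xs pa pb)
... | false rewrite ≢⇒≡ᵇ≡false {x} {a} (λ { refl → contradiction (trans (sym pa) px) λ () })
                  | ≢⇒≡ᵇ≡false {x} {b} (λ { refl → contradiction (trans (sym pb) px) λ () }) =
  before-filterB p xs pa pb

filterB-shiftBy : ∀ p acc l → All (λ c → p c ≡ false) acc → filterB p (shiftBy p acc l) ≡ filterB p l
filterB-shiftBy p acc []      h = filterB-none p (All-reverse acc h)
filterB-shiftBy p acc (a ∷ l) h with p a in pa
... | true rewrite pa | filterB-++ p (reverse acc) (shiftBy p [] l) | filterB-none p (All-reverse acc h) =
  cong (a ∷_) (filterB-shiftBy p [] l [])
... | false = filterB-shiftBy p (a ∷ acc) l (pa ∷ h)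

filterB-not-shiftBy : ∀ p acc l → All (λ c → p c ≡ false) acc →
  filterB (not ∘ p) (shiftBy p acc l) ≡ reverse acc ++ filterB (not ∘ p) l
filterB-not-shiftBy p acc []      h =
  trans (filterB-all (not ∘ p) (All-reverse acc (All.map (cong not) h))) (sym (List.++-identityʳ (reverse acc)))
filterB-not-shiftBy p acc (a ∷ l) h with p a in pa
... | true rewrite pa | filterB-++ (not ∘ p) (reverse acc) (shiftBy p [] l)
                 | filterB-all (not ∘ p) (All-reverse acc (All.map (cong not) h)) =
  cong (reverse acc ++_) (filterB-not-shiftBy p [] l [])
... | false = trans (filterB-not-shiftBy p (a ∷ acc) l (pa ∷ h)) (reverse-∷-++ a acc (filterB (not ∘ p) l))

-- restricted to either class of p, shiftBy p moves nothing
before-shiftBy : ∀ p {a b} γ → p a ≡ p b → before b a (shiftBy p [] γ) ≡ before b a γ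
before-shiftBy p {a} {b} γ pa≡pb with p a in pa
... | true  = begin
  before b a (shiftBy p [] γ)             ≡⟨ before-filterB p (shiftBy p [] γ) pa (sym pa≡pb) ⟨
  before b a (filterB p (shiftBy p [] γ)) ≡⟨ cong (before b a) (filterB-shiftBy p [] γ []) ⟩
  before b a (filterB p γ)                ≡⟨ before-filterB p γ pa (sym pa≡pb) ⟩
  before b a γ                            ∎
  where open ≡-Reasoning
... | false = begin
  before b a (shiftBy p [] γ)
    ≡⟨ before-filterB (not ∘ p) (shiftBy p [] γ) (cong not pa) (cong not (sym pa≡pb)) ⟨
  before b a (filterB (not ∘ p) (shiftBy p [] γ)) ≡⟨ cong (before b a) (filterB-not-shiftBy p [] γ []) ⟩
  before b a (filterB (not ∘ p) γ)              ≡⟨ before-filterB (not ∘ p) γ (cong not pa) (cong not (sym pa≡pb)) ⟩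
  before b a γ                                  ∎
  where open ≡-Reasoning

before-foataRotate : ∀ l x {a b} γ → (a ≤ᵇ x) ≡ (b ≤ᵇ x) → before b a (foataRotate l x γ) ≡ before b a γ
before-foataRotate l x γ e with l ≤ᵇ x
... | true  = before-shiftBy (_≤ᵇ x) γ e
... | false = before-shiftBy (not ∘ (_≤ᵇ x)) γ (cong not e)

before-++-↭ : ∀ {a b u u′} v → u ↭ u′ → ¬ (a ∈ u × b ∈ u) → before b a (u ++ v) ≡ before b a (u′ ++ v)
before-++-↭ {a} {b} {u} {u′} v q not-both = by-membership (a ∈? u) (b ∈? u)
  where
  to : ∀ {x} → x ∈ u → x ∈ u′
  to = Perm.∈-resp-↭ q
  from : ∀ {x} → x ∈ u′ → x ∈ u
  from = Perm.∈-resp-↭ (↭-sym q)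
  by-membership : Dec (a ∈ u) → Dec (b ∈ u) → before b a (u ++ v) ≡ before b a (u′ ++ v)
  by-membership (yes a∈) (yes b∈) = ⊥-elim (not-both (a∈ , b∈))
  by-membership (yes a∈) (no  b∉) =
    trans (before-++-∈-∉ u v a∈ b∉) (sym (before-++-∈-∉ u′ v (to a∈) (b∉ ∘ from)))
  by-membership (no  a∉) (yes b∈) =
    trans (before-++-∉-∈ u v a∉ b∈) (sym (before-++-∉-∈ u′ v (a∉ ∘ from) (to b∈)))
  by-membership (no  a∉) (no  b∉) =
    trans (before-++-∉ u v a∉ b∉) (sym (before-++-∉ u′ v (a∉ ∘ from) (b∉ ∘ from)))

before-F2 : ∀ {a b} → (∀ {x} → x ≢ a → x ≢ b → (a ≤ᵇ x) ≡ (b ≤ᵇ x)) →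
            ∀ w → Unique w → before b a (F2 w) ≡ before b a w
before-F2 {a} {b} unseparated = ∷ʳ-induction (λ w → Unique w → before b a (F2 w) ≡ before b a w) (λ _ → refl) step
  where
  step : ∀ w x → (Unique w → before b a (F2 w) ≡ before b a w) →
         Unique (w ++ (x ∷ [])) → before b a (F2 (w ++ (x ∷ []))) ≡ before b a (w ++ (x ∷ []))
  step []       x _  _ = refl
  step (y ∷ ys) x ih u =
    trans (cong (before b a) (trans (F2-∷ʳ w x) (foataStep-lastL (F2 w) x (trans (lastL-F2 w) (lastL-∷ y ys)))))
          (by-membership (a ∈? w) (b ∈? w))
    where
    w = y ∷ ys
    l = lastOr y ys
    rotated = foataRotate l x (F2 w)
    rotated↭w : rotated ↭ w
    rotated↭w = ↭-trans (foataRotate-↭ l x (F2 w)) (F2-↭ w)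
    x∉w : x ∉ w
    x∉w x∈ = Unique-++⇒∉ w u x∈ (here refl)
    by-membership : Dec (a ∈ w) → Dec (b ∈ w) → before b a (rotated ++ (x ∷ [])) ≡ before b a (w ++ (x ∷ []))
    by-membership (yes a∈) (yes b∈) = begin
      before b a (rotated ++ (x ∷ [])) ≡⟨ before-++ rotated (x ∷ []) (inj₁ (Perm.∈-resp-↭ (↭-sym rotated↭w) a∈)) ⟩
      before b a rotated               ≡⟨ before-foataRotate l x (F2 w)
                                            (unseparated (x∉w ∘ λ { refl → a∈ }) (x∉w ∘ λ { refl → b∈ })) ⟩
      before b a (F2 w)                ≡⟨ ih (Unique-++⁻ˡ w u) ⟩
      before b a w                     ≡⟨ before-++ w (x ∷ []) (inj₁ a∈) ⟨
      before b a (w ++ (x ∷ []))       ∎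
      where open ≡-Reasoning
    by-membership (yes a∈) (no b∉) = sym (before-++-↭ (x ∷ []) (↭-sym rotated↭w) (b∉ ∘ proj₂))
    by-membership (no a∉)  _       = sym (before-++-↭ (x ∷ []) (↭-sym rotated↭w) (a∉ ∘ proj₁))

-- F2' preserves descents, so it maps desarrangements to desarrangements

descents : List ℕ → List Bool
descents []           = []
descents (x ∷ [])     = []
descents (x ∷ y ∷ ys) = (y <ᵇ x) ∷ descents (y ∷ ys)

decRun-descents : ∀ w w′ → length w ≡ length w′ → descents w ≡ descents w′ → decRun w ≡ decRun w′
decRun-descents []           []             _   _ = refl
decRun-descents (x ∷ [])     (x′ ∷ [])      _   _ = refl
decRun-descents (x ∷ y ∷ ys) (x′ ∷ y′ ∷ ys′) len d =
  cong₂ (λ b r → if b then suc r else 1) (List.∷-injectiveˡ d)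
        (decRun-descents (y ∷ ys) (y′ ∷ ys′) (suc-injective len) (List.∷-injectiveʳ d))
decRun-descents (x ∷ [])     (x′ ∷ y′ ∷ ys′) () _
decRun-descents (x ∷ y ∷ ys) (x′ ∷ [])       () _

isDesarr-descents : ∀ w w′ → length w ≡ length w′ → descents w ≡ descents w′ → isDesarr w ≡ isDesarr w′
isDesarr-descents []       []         _   _ = refl
isDesarr-descents (x ∷ xs) (x′ ∷ xs′) len d = cong even (decRun-descents (x ∷ xs) (x′ ∷ xs′) len d)

descents≡map-at : ∀ w → descents w ≡ map (λ i → at w (suc (suc i)) <ᵇ at w (suc i)) (range 0 (length w ∸ 1))
descents≡map-at []           = refl
descents≡map-at (x ∷ [])     = refl
descents≡map-at (x ∷ y ∷ ys) = cong ((y <ᵇ x) ∷_) (trans (descents≡map-at (y ∷ ys))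
  (sym (trans (cong (map _) (range-suc 0 (length ys))) (sym (List.map-∘ (range 0 (length ys)))))))

∈-range-∸1⇒suc< : ∀ {m j} → j ∈ range 0 (m ∸ 1) → suc j < m
∈-range-∸1⇒suc< {suc m} j∈ = s≤s (proj₂ (∈-range⁻ j∈))

module _ {m δ} (δ↭ : IsPermutation m δ) where

  private
    δ⁻¹↭ = inverse-IsPermutation δ↭
    F2δ⁻¹↭ : IsPermutation m (F2 (inverse δ))
    F2δ⁻¹↭ = ↭-trans (F2-↭ (inverse δ)) δ⁻¹↭

  F2'-IsPermutation : IsPermutation m (F2' δ)
  F2'-IsPermutation = inverse-IsPermutation F2δ⁻¹↭

  inv-F2' : inv (F2' δ) ≡ imaj δ
  inv-F2' = trans (inv-inverse F2δ⁻¹↭) (inv-F2 (inverse δ))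

  -- i + 1 precedes i in π exactly when π⁻¹ has a descent at i, and the values i, i + 1 are never separated
  descent-F2' : ∀ j → suc j < m → (at (F2' δ) (2 + j) <ᵇ at (F2' δ) (suc j)) ≡ (at δ (2 + j) <ᵇ at δ (suc j))
  descent-F2' j j+1<m = begin
    (at (inverse u) (2 + j) <ᵇ at (inverse u) (suc j))
      ≡⟨ cong₂ _<ᵇ_ (at-inverse F2δ⁻¹↭ (suc j) j+1<m) (at-inverse F2δ⁻¹↭ j j<m) ⟩
    (posOf (2 + j) u <ᵇ posOf (suc j) u)
      ≡⟨ posOf<ᵇposOf≡before u j+1≢j+2 (IsPermutation-∋ F2δ⁻¹↭ j<m) (IsPermutation-∋ F2δ⁻¹↭ j+1<m) ⟩
    before (2 + j) (suc j) u
      ≡⟨ before-F2 unseparated v (IsPermutation⇒Unique δ⁻¹↭) ⟩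
    before (2 + j) (suc j) v
      ≡⟨ posOf<ᵇposOf≡before v j+1≢j+2 (IsPermutation-∋ δ⁻¹↭ j<m) (IsPermutation-∋ δ⁻¹↭ j+1<m) ⟨
    (posOf (2 + j) v <ᵇ posOf (suc j) v)
      ≡⟨ cong₂ _<ᵇ_ (posOf-inverse δ↭ (suc j) j+1<m) (posOf-inverse δ↭ j j<m) ⟩
    (at δ (2 + j) <ᵇ at δ (suc j))                   ∎
    where
    open ≡-Reasoning
    v = inverse δ
    u = F2 v
    j<m : j < m
    j<m = <-trans (n<1+n j) j+1<m
    j+1≢j+2 : suc j ≢ 2 + j
    j+1≢j+2 = <⇒≢ (n<1+n (suc j))
    unseparated : ∀ {x} → x ≢ suc j → x ≢ 2 + j → (suc j ≤ᵇ x) ≡ (2 + j ≤ᵇ x)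
    unseparated {x} x≢j+1 _ with suc j ≤? x
    ... | yes j+1≤x = trans (≤⇒≤ᵇ≡true j+1≤x) (sym (≤⇒≤ᵇ≡true (≤∧≢⇒< j+1≤x (x≢j+1 ∘ sym))))
    ... | no  j+1≰x = trans (≰⇒≤ᵇ≡false j+1≰x) (sym (≰⇒≤ᵇ≡false (j+1≰x ∘ <⇒≤)))

  isDesarr-F2' : isDesarr (F2' δ) ≡ isDesarr δ
  isDesarr-F2' = isDesarr-descents (F2' δ) δ (trans F2'-length (sym (IsPermutation⇒length δ↭)))
    (trans (descents≡map-at (F2' δ))
    (trans (cong (λ k → map _ (range 0 (k ∸ 1))) F2'-length)
    (trans (List.map-cong-local (All.tabulate (λ {j} j∈ → descent-F2' j (∈-range-∸1⇒suc< j∈))))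
    (sym (trans (descents≡map-at δ) (cong (λ k → map _ (range 0 (k ∸ 1))) (IsPermutation⇒length δ↭)))))))
    where
    F2'-length : length (F2' δ) ≡ m
    F2'-length = IsPermutation⇒length F2'-IsPermutation

inv-ascending-++ : ∀ {P} E → AllPairs _<_ P → inv (P ++ E) ≡ cross P E + inv E
inv-ascending-++ {P} E asc =
  trans (inv-++ P E) (trans (cong (λ i → i + inv E + cross P E) (inv-ascending asc)) (+-comm (inv E) (cross P E)))

NoDescent : List ℕ → Set
NoDescent = Linked (λ x y → (y <ᵇ x) ≡ false)

pixPart-NoDescent : ∀ σ → NoDescent (pixPart σ)
pixPart-NoDescent []       = []
pixPart-NoDescent (x ∷ xs) with isDesarr (x ∷ xs) in x∷xs-desarr
... | true = []
pixPart-NoDescent (x ∷ []) | false = [-]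
pixPart-NoDescent (x ∷ y ∷ ys) | false with isDesarr (y ∷ ys) in y∷ys-desarr | pixPart-NoDescent (y ∷ ys)
... | true  | _  = [-]
... | false | ih = no-descent ∷ ih
  where
  -- a descent x > y would make x ∷ y ∷ ys a desarrangement, since y ∷ ys has an odd initial run
  no-descent : (y <ᵇ x) ≡ false
  no-descent with y <ᵇ x in y<x
  ... | false = refl
  ... | true  = contradiction (trans (sym (trans (even-suc (decRun (y ∷ ys))) (cong not y∷ys-desarr))) x∷xs-desarr) λ ()

desPart-isDesarr : ∀ σ → isDesarr (desPart σ) ≡ true
desPart-isDesarr []       = refl
desPart-isDesarr (x ∷ xs) with isDesarr (x ∷ xs) in x∷xs-desarr
... | true  = x∷xs-desarr
... | false = desPart-isDesarr xs

isDesarr-NoDescent-++ : ∀ x P E → isDesarr E ≡ true → NoDescent (x ∷ P) → isDesarr (x ∷ P ++ E) ≡ false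
isDesarr-NoDescent-++ x (y ∷ P) E _ (y≮x ∷ _) rewrite y≮x = refl
isDesarr-NoDescent-++ x []      []       _ _ = refl
isDesarr-NoDescent-++ x []      (z ∷ zs) E-desarr _ with z <ᵇ x
... | true  = trans (even-suc (decRun (z ∷ zs))) (cong not E-desarr)
... | false = refl

pixLen-++ : ∀ P E → NoDescent P → isDesarr E ≡ true → pixLen (P ++ E) ≡ length P
pixLen-++ []      []      _  _        = refl
pixLen-++ []      (y ∷ ys) _ E-desarr rewrite E-desarr = refl
pixLen-++ (x ∷ P) E       nd E-desarr rewrite isDesarr-NoDescent-++ x P E E-desarr nd =
  cong suc (pixLen-++ P E (Linked.tail nd) E-desarr)

take-length-++ : ∀ (xs ys : List ℕ) → take (length xs) (xs ++ ys) ≡ xs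
take-length-++ []       ys = refl
take-length-++ (x ∷ xs) ys = cong (x ∷_) (take-length-++ xs ys)

PIX-++ : ∀ P E → NoDescent P → isDesarr E ≡ true → PIX (P ++ E) ≡ P
PIX-++ P E nd E-desarr = trans (cong (λ k → take k (P ++ E)) (pixLen-++ P E nd E-desarr)) (take-length-++ P E)

NoDescent-Unique⇒ascending : ∀ {P} → NoDescent P → Unique P → AllPairs _<_ P
NoDescent-Unique⇒ascending nd u = Linked⇒AllPairs <-trans (strict nd u)
  where
  strict : ∀ {P} → NoDescent P → Unique P → Linked _<_ P
  strict []              _               = []
  strict [-]             _               = [-]
  strict (y≮x ∷ nd) ((x≢y ∷ _) ∷ u) = ≤∧≢⇒< (≮⇒≥ (<ᵇ≡false⇒≮ y≮x)) x≢y ∷ strict nd u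

-- The letters of [n] outside PIX σ, and the crossing count behind mag

elemB≡true⇒∈ : ∀ x xs → elemB x xs ≡ true → x ∈ xs
elemB≡true⇒∈ x (y ∷ xs) e with y ≡ᵇ x in y≡x
... | true  = here (sym (≡ᵇ≡true⇒≡ y≡x))
... | false = there (elemB≡true⇒∈ x xs e)

∈⇒elemB≡true : ∀ {x xs} → x ∈ xs → elemB x xs ≡ true
∈⇒elemB≡true {x} (here refl) rewrite ≡⇒≡ᵇ≡true {x} refl = refl
∈⇒elemB≡true {x} {y ∷ xs} (there m) rewrite ∈⇒elemB≡true m with y ≡ᵇ x
... | true  = refl
... | false = refl

∉⇒elemB≡false : ∀ {x xs} → x ∉ xs → elemB x xs ≡ false
∉⇒elemB≡false {x} {xs} x∉ with elemB x xs in e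
... | false = refl
... | true  = ⊥-elim (x∉ (elemB≡true⇒∈ x xs e))

complementIn : ℕ → List ℕ → List ℕ
complementIn n P = filterB (λ i → not (elemB i P)) (oneTo n)

countB-<-range : ∀ a k {p} → a ≤ p → p ≤ a + k → countB (_<ᵇ p) (range a k) + a ≡ p
countB-<-range a zero    a≤p p≤a = ≤-antisym a≤p (subst (_ ≤_) (+-identityʳ a) p≤a)
countB-<-range a (suc k) {p} a≤p p≤a+k with a ≟ p
... | yes refl =
  cong (_+ a) (countB-none _ (All.tabulate λ y∈ → ≮⇒<ᵇ≡false (≤⇒≯ (proj₁ (∈-range⁻ {a} {suc k} y∈)))))
... | no  a≢p rewrite <⇒<ᵇ≡true (≤∧≢⇒< a≤p a≢p) =
  trans (sym (+-suc _ a)) (countB-<-range (suc a) k (≤∧≢⇒< a≤p a≢p) (subst (p ≤_) (+-suc a k) p≤a+k))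

sum-map-suc : ∀ xs → sum (map suc xs) ≡ length xs + sum xs
sum-map-suc []       = refl
sum-map-suc (x ∷ xs) = trans (cong (suc x +_) (sum-map-suc xs)) (lemma x (length xs) (sum xs))
  where
  lemma : ∀ a b c → suc a + (b + c) ≡ suc b + (a + c)
  lemma = solve-∀

-- the i-th letter of an ascending list has rank i in it
sum-rank-ascending : ∀ {P} → AllPairs _<_ P → sum (map (rank P) P) ≡ sum (range 1 (length P))
sum-rank-ascending {[]}     []         = refl
sum-rank-ascending {x ∷ xs} (x< ∷ asc) = begin
    rank (x ∷ xs) x + sum (map (rank (x ∷ xs)) xs)
  ≡⟨ cong₂ _+_ x-lowest (sum-map-cong _ (suc ∘ rank xs) xs x-below) ⟩
    suc (sum (map (suc ∘ rank xs) xs))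
  ≡⟨ cong suc (trans (cong sum (List.map-∘ xs)) (sum-map-suc (map (rank xs) xs))) ⟩
    suc (length (map (rank xs) xs) + sum (map (rank xs) xs))
  ≡⟨ cong suc (cong₂ _+_ (trans (List.length-map (rank xs) xs) (sym (length-range 1 (length xs))))
                         (sum-rank-ascending asc)) ⟩
    suc (length (range 1 (length xs)) + sum (range 1 (length xs)))
  ≡⟨ cong suc (trans (cong sum (range-suc 1 (length xs))) (sum-map-suc (range 1 (length xs)))) ⟨
    sum (range 1 (suc (length xs))) ∎
  where
  open ≡-Reasoning
  x-lowest : rank (x ∷ xs) x ≡ 1
  x-lowest = cong suc (countB-none _ (≮⇒<ᵇ≡false (<-irrefl {x} refl) ∷ All.map (≮⇒<ᵇ≡false ∘ <⇒≯) x<))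
  x-below : ∀ {q} → q ∈ xs → rank (x ∷ xs) q ≡ suc (rank xs q)
  x-below q∈ rewrite <⇒<ᵇ≡true (All.lookup x< q∈) = refl

module _ {n} P D (P++D↭ : IsPermutation n (P ++ D)) where

  complementIn-↭ : complementIn n P ↭ D
  complementIn-↭ = begin
    complementIn n P              ≡⟨ cong (filterB notInP) (oneTo≡range n) ⟩
    filterB notInP (range 1 n)    ↭⟨ filterB-↭ notInP (↭-sym P++D↭) ⟩
    filterB notInP (P ++ D)       ≡⟨ filterB-++ notInP P D ⟩
    filterB notInP P ++ filterB notInP D
      ≡⟨ cong₂ _++_ (filterB-none notInP {P} (All.tabulate (cong not ∘ ∈⇒elemB≡true)))
                    (filterB-all notInP {D} (All.tabulate (cong not ∘ ∉⇒elemB≡false ∘ ∉P))) ⟩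
    D                             ∎
    where
    open ↭.PermutationReasoning
    notInP : ℕ → Bool
    notInP i = not (elemB i P)
    ∉P : ∀ {d} → d ∈ D → d ∉ P
    ∉P d∈ p∈ = Unique-++⇒∉ P (IsPermutation⇒Unique P++D↭) p∈ d∈

  complementIn-ascending : AllPairs _<_ (complementIn n P)
  complementIn-ascending =
    subst (AllPairs _<_) (cong (filterB _) (sym (oneTo≡range n))) (filterB-ascending _ (range-ascending 1 n))

  -- the letters of [n] below p ∈ P are the p − 1 letters 1, …, p − 1, split between P and D
  countB-<-split : ∀ {p} → p ∈ P → countB (_<ᵇ p) D + rank P p ≡ p
  countB-<-split {p} p∈ with 1≤p , p<1+n ← ∈-range⁻ (Perm.∈-resp-↭ P++D↭ (∈-++⁺ˡ p∈)) = begin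
    countB (_<ᵇ p) D + suc (countB (_<ᵇ p) P) ≡⟨ +-suc _ _ ⟩
    suc (countB (_<ᵇ p) D + countB (_<ᵇ p) P) ≡⟨ cong suc (+-comm (countB (_<ᵇ p) D) _) ⟩
    suc (countB (_<ᵇ p) P + countB (_<ᵇ p) D) ≡⟨ cong suc (countB-++ (_<ᵇ p) P D) ⟨
    suc (countB (_<ᵇ p) (P ++ D))             ≡⟨ cong suc (countB-↭ _ P++D↭) ⟩
    suc (countB (_<ᵇ p) (range 1 n))          ≡⟨ +-comm 1 _ ⟩
    countB (_<ᵇ p) (range 1 n) + 1            ≡⟨ countB-<-range 1 n 1≤p (<⇒≤ p<1+n) ⟩
    p                                         ∎
    where open ≡-Reasoning

  cross+sum-range≡sum : ∀ {E} → AllPairs _<_ P → E ↭ D → cross P E + sum (range 1 (length P)) ≡ sum P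
  cross+sum-range≡sum {E} asc E↭D = begin
    cross P E + sum (range 1 (length P))            ≡⟨ cong₂ _+_ (cross-↭ʳ P E↭D) (sym (sum-rank-ascending asc)) ⟩
    cross P D + sum (map (rank P) P)                ≡⟨ sum-map-+ (λ p → countB (_<ᵇ p) D) (rank P) P ⟨
    sum (map (λ p → countB (_<ᵇ p) D + rank P p) P) ≡⟨ sum-map-cong _ (λ p → p) P countB-<-split ⟩
    sum (map (λ p → p) P)                           ≡⟨ cong sum (List.map-id P) ⟩
    sum P                                           ∎
    where open ≡-Reasoning

  private
    δ↭ : IsPermutation (length D) (standardize D)
    δ↭ = standardize-IsPermutation D (Unique-++⁻ʳ P (IsPermutation⇒Unique P++D↭))
    module Relabel = RelabelByAscending (complementIn n P) complementIn-ascending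
                                        (Perm.↭-length complementIn-↭) (F2'-IsPermutation δ↭)

  relabelled : List ℕ
  relabelled = map (at (complementIn n P)) (F2' (standardize D))

  isDesarr-relabelled : isDesarr relabelled ≡ isDesarr D
  isDesarr-relabelled = begin
    isDesarr relabelled               ≡⟨ isDesarr-map (at (complementIn n P)) _ Relabel.at-preservesOrder ⟩
    isDesarr (F2' (standardize D))    ≡⟨ isDesarr-F2' δ↭ ⟩
    isDesarr (standardize D)          ≡⟨ isDesarr-map (rank D) D (rank-preservesOrder D) ⟩
    isDesarr D                        ∎
    where open ≡-Reasoning

  inv-ascending-++-relabelled : AllPairs _<_ P →
    inv (P ++ relabelled) ≡ sum P ∸ sum (range 1 (length P)) + imaj (standardize D)
  inv-ascending-++-relabelled asc = begin
    inv (P ++ relabelled)                           ≡⟨ inv-ascending-++ relabelled asc ⟩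
    cross P relabelled + inv relabelled             ≡⟨ cong (_+ inv relabelled) (m+n∸n≡m _ (sum [p])) ⟨
    cross P relabelled + sum [p] ∸ sum [p] + inv relabelled
      ≡⟨ cong₂ (λ s i → s ∸ sum [p] + i) (cross+sum-range≡sum asc (↭-trans Relabel.map-at-↭ complementIn-↭))
                                         inv-relabelled ⟩
    sum P ∸ sum [p] + imaj (standardize D)         ∎
    where
    open ≡-Reasoning
    [p] = range 1 (length P)
    inv-relabelled : inv relabelled ≡ imaj (standardize D)
    inv-relabelled = trans (inv-map (at (complementIn n P)) _ Relabel.at-preservesOrder) (inv-F2' δ↭)

proposition2p6 : (n : ℕ) (σ : List ℕ) → σ ↭ oneTo n →
    (PIX σ ≡ PIX (F2loc σ)) × (mag σ ≡ inv (F2loc σ))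
proposition2p6 n σ σ↭ = sym PIX-F2loc , mag≡inv
  where
  P = PIX σ
  D = desPart σ
  σ↭[n] : IsPermutation n σ
  σ↭[n] = ↭-trans σ↭ (↭-reflexive (oneTo≡range n))
  P++D↭ : IsPermutation (length σ) (P ++ D)
  P++D↭ = subst₂ IsPermutation (sym (IsPermutation⇒length σ↭[n])) (sym (List.take++drop≡id (pixLen σ) σ)) σ↭[n]
  PIX-F2loc : PIX (F2loc σ) ≡ P
  PIX-F2loc = PIX-++ P _ (pixPart-NoDescent σ) (trans (isDesarr-relabelled P D P++D↭) (desPart-isDesarr σ))
  P-ascending : AllPairs _<_ P
  P-ascending = NoDescent-Unique⇒ascending (pixPart-NoDescent σ) (Unique-++⁻ˡ P (IsPermutation⇒Unique P++D↭))
  mag≡inv : mag σ ≡ inv (F2loc σ)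
  mag≡inv = trans (cong (λ s → sum P ∸ sum s + imaj (Desar σ)) (oneTo≡range (length P)))
                  (sym (inv-ascending-++-relabelled P D P++D↭ P-ascending))
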